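{- Let $(T,\omega)$ be a weighted tree, $\mathcal W$ its multiset of vertex weights, and $w_0,w_1,w_2$ (not necessarily distinct) numbers occurring in $\mathcal W$. Then: (a) the coefficient $\alpha(w_1,w_2):=[z_{w_1+w_2,1}\,\mathbf z_{\mathcal W\setminus\{w_1,w_2\}}]M(\mathbf z)$ equals the number of edges joining a vertex of weight $w_1$ with a vertex of weight $w_2$; (b) the coefficient $\beta(w_0,w_1,w_2):=[z_{w_0+w_1,1}\,z_{w_0+w_2,1}\,\mathbf z_{\mathcal W\setminus\{w_0,w_0,w_1,w_2\}}]M(\mathbf z)$ equals the number of sets $\{e_1,e_2\}$ of two independent (vertex-disjoint) edges such that, for $i=1,2$, $e_i$ joins a vertex of weight $w_0$ with a vertex of weight $w_i$.
   Context: Here $M(\mathbf z)=M_{(T,\mathsf m_\omega)}(\mathbf z)=\sum_{A\subseteq E(T)}\prod_C z_{\mathsf m(C)}$, where $\mathsf m_\omega(v)=(\omega(v),0)$, $C$ ranges over connected components of the spanning subgraph $(V(T),A)$, $\mathsf m(C)$ is the dot-sum of the marks of the vertices of $C$ with $(w,d)\dotplus(w',d')=(w+w',d+d'+1)$, and the $z_{w,d}$ are commuting indeterminates. For a multiset $\mathcal U$ of positive integers, $\mathbf z_{\mathcal U}=\prod_{u\in\mathcal U}z_{u,0}$; $\mathcal W\setminus\{a,b,\dots\}$ removes one occurrence of each listed element (with multiplicity). $[\mathbf m]f$ is the coefficient of the monomial $\mathbf m$ in $f$. In (b), if $\mathcal W$ does not contain enough occurrences of $w_0,w_1,w_2$ for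 the removal, $\beta(w_0,w_1,w_2)$ is defined to be $0$. -}

module Defs where

open import Data.Nat using (ℕ; zero; suc; _+_; _∸_; _≡ᵇ_; _<_; _≤_)
open import Data.Bool using (Bool; true; false; _∧_; _∨_; not; if_then_else_)
open import Data.Fin using (Fin; toℕ)
open import Data.Product using (_×_; _,_; proj₁; proj₂)
open import Data.List using (List; []; _∷_; map; length; allFin; filterᵇ; _++_)
open import Data.Bool.ListAction using (any; all)
open import Data.List.Relation.Unary.All using (All)
open import Data.List.Relation.Unary.AllPairs using (AllPairs)
open import Data.Maybe using (Maybe; just; nothing)
open import Relation.Binary.PropositionalEquality using (_≡_; _≢_)

-- Graphs on the vertex set Fin n; an edge is a pair of vertices,
-- read as an unordered edge {u , v}.

Edge : ℕ → Set
Edge n = Fin n × Fin n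

_==_ : ∀ {n} → Fin n → Fin n → Bool
u == v = toℕ u ≡ᵇ toℕ v

sameEdge : ∀ {n} → Edge n → Edge n → Bool
sameEdge (a , b) (c , d) = ((a == c) ∧ (b == d)) ∨ ((a == d) ∧ (b == c))

reachStep : ∀ {n} → ℕ → List (Edge n) → Fin n → Fin n → Bool
reachStep zero    A u v = u == v
reachStep (suc k) A u v =
  reachStep k A u v ∨
  any (λ e → (reachStep k A u (proj₁ e) ∧ (proj₂ e == v)) ∨
             (reachStep k A u (proj₂ e) ∧ (proj₁ e == v))) A

-- u and v lie in the same connected component of (Fin n , A)
-- (walks of length ≤ n suffice, since simple paths have < n edges)
connected : ∀ {n} → List (Edge n) → Fin n → Fin n → Bool
connected {n} A u v = reachStep n A u v

record IsTree (n : ℕ) (E : List (Edge n)) : Set where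
  field
    nonempty   : 1 ≤ n
    loopless   : All (λ e → proj₁ e ≢ proj₂ e) E
    noMultiple : AllPairs (λ e f → sameEdge e f ≡ false) E
    conn       : ∀ u v → connected E u v ≡ true
    edgeCount  : length E + 1 ≡ n

-- Marks and the polynomial M.  A mark (w , d) indexes z_{w,d}; a monomial
-- in the commuting indeterminates z_{w,d} is a multiset of marks, which we
-- represent by a list (up to reordering).

Mark : Set
Mark = ℕ × ℕ

subsets : ∀ {a} {X : Set a} → List X → List (List X)
subsets []       = [] ∷ []
subsets (x ∷ xs) = let r = subsets xs in r ++ map (x ∷_) r

-- representatives of components of (Fin n , A): least vertex of each component
isRep : ∀ {n} → List (Edge n) → Fin n → Bool
isRep {n} A r = all (λ u → not ((toℕ u Data.Nat.<ᵇ toℕ r) ∧ connected A u r)) (allFin n)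

component : ∀ {n} → List (Edge n) → Fin n → List (Fin n)
component {n} A r = filterᵇ (connected A r) (allFin n)

-- mark of a component C: the dot-sum of the marks (ω v , 0), v ∈ C,
-- i.e. (Σ ω v , |C| - 1)
dotSum : List Mark → Mark
dotSum []       = (0 , 0)
dotSum (m ∷ []) = m
dotSum ((w , d) ∷ ms@(_ ∷ _)) with dotSum ms
... | (w' , d') = (w + w' , d + d' + 1)

compMark : ∀ {n} → (Fin n → ℕ) → List (Edge n) → Fin n → Mark
compMark ω A r = dotSum (map (λ v → (ω v , 0)) (component A r))

-- the monomial ∏_C z_{m(C)} of the spanning subgraph (V , A)
monomial : ∀ {n} → (Fin n → ℕ) → List (Edge n) → List Mark
monomial {n} ω A = map (compMark ω A) (filterᵇ (isRep A) (allFin n))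

-- equality of monomials = equality of multisets of marks
_=ᴹ_ : Mark → Mark → Bool
(a , b) =ᴹ (c , d) = (a ≡ᵇ c) ∧ (b ≡ᵇ d)

occ : Mark → List Mark → ℕ
occ m l = length (filterᵇ (m =ᴹ_) l)

sameMonomial : List Mark → List Mark → Bool
sameMonomial l k = all (λ m → (occ m l ≡ᵇ occ m k)) (l ++ k)

-- [m] M_{(T, m_ω)}(z) = Σ_{A ⊆ E} [m] ∏_C z_{m(C)}
--                    = #{ A ⊆ E | ∏_C z_{m(C)} = m }
coeffM : ∀ {n} → (Fin n → ℕ) → List (Edge n) → List Mark → ℕ
coeffM ω E m = length (filterᵇ (λ A → sameMonomial (monomial ω A) m) (subsets E))

weights : ∀ {n} → (Fin n → ℕ) → List ℕ
weights {n} ω = map ω (allFin n)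

removeOne : ℕ → List ℕ → Maybe (List ℕ)
removeOne x []       = nothing
removeOne x (y ∷ ys) = if x ≡ᵇ y then just ys else Data.Maybe.map (y ∷_) (removeOne x ys)

removeAll : List ℕ → List ℕ → Maybe (List ℕ)
removeAll []       W = just W
removeAll (x ∷ xs) W with removeOne x W
... | nothing = nothing
... | just W' = removeAll xs W'

zU : List ℕ → List Mark
zU = map (λ u → (u , 0))

α : ∀ {n} → (Fin n → ℕ) → List (Edge n) → ℕ → ℕ → ℕ
α ω E w₁ w₂ with removeAll (w₁ ∷ w₂ ∷ []) (weights ω)
... | nothing = 0
... | just R  = coeffM ω E ((w₁ + w₂ , 1) ∷ zU R)

β : ∀ {n} → (Fin n → ℕ) → List (Edge n) → ℕ → ℕ → ℕ → ℕ
β ω E w₀ w₁ w₂ with removeAll (w₀ ∷ w₀ ∷ w₁ ∷ w₂ ∷ []) (weights ω)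
... | nothing = 0
... | just R  = coeffM ω E ((w₀ + w₁ , 1) ∷ (w₀ + w₂ , 1) ∷ zU R)

joins : ∀ {n} → (Fin n → ℕ) → ℕ → ℕ → Edge n → Bool
joins ω a b (u , v) = ((ω u ≡ᵇ a) ∧ (ω v ≡ᵇ b)) ∨ ((ω u ≡ᵇ b) ∧ (ω v ≡ᵇ a))

numJoining : ∀ {n} → (Fin n → ℕ) → List (Edge n) → ℕ → ℕ → ℕ
numJoining ω E a b = length (filterᵇ (joins ω a b) E)

disjointEdges : ∀ {n} → Edge n → Edge n → Bool
disjointEdges (a , b) (c , d) = not ((a == c) ∨ (a == d) ∨ (b == c) ∨ (b == d))

-- unordered pairs {e , f} of distinct edges: pairs of positions i < j in E
unorderedPairs : ∀ {a} {X : Set a} → List X → List (X × X)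
unorderedPairs []       = []
unorderedPairs (x ∷ xs) = map (x ,_) xs ++ unorderedPairs xs

goodPair : ∀ {n} → (Fin n → ℕ) → ℕ → ℕ → ℕ → Edge n × Edge n → Bool
goodPair ω w₀ w₁ w₂ (e , f) =
  disjointEdges e f ∧
  ((joins ω w₀ w₁ e ∧ joins ω w₀ w₂ f) ∨ (joins ω w₀ w₂ e ∧ joins ω w₀ w₁ f))

numIndepPairs : ∀ {n} → (Fin n → ℕ) → List (Edge n) → ℕ → ℕ → ℕ → ℕ
numIndepPairs ω E w₀ w₁ w₂ = length (filterᵇ (goodPair ω w₀ w₁ w₂) (unorderedPairs E))

{-# OPTIONS --safe #-}
-- When 𝐦 has no mark of degree ≥ 2, every component of (V , A) has at most
-- two vertices, so A is a matching of the simple graph T; the marks of a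
-- matching are (ω u + ω v , 1) for its edges uv and (ω x , 0) for the
-- uncovered vertices x.  Comparing the degree-0 marks with 𝓦 minus the
-- removed weights, and the degree-1 marks with the prescribed sums, A counts
-- for α exactly when it is one edge with endpoint weights {w₁, w₂}, and for β
-- exactly when it is two disjoint edges whose endpoint weights split
-- {w₀, w₀, w₁, w₂} into pairs with sums w₀ + w₁ and w₀ + w₂.
module Submission where

open import Defs
open import Data.Nat using (ℕ; zero; suc; _+_; _∸_; _≡ᵇ_; _<ᵇ_; _<_; _≤_; z≤n; s≤s)
open import Data.Nat.Properties
open import Data.Bool using (Bool; true; false; _∧_; _∨_; not; if_then_else_; T)
open import Data.Bool.Properties using (∧-identityʳ; ∧-zeroʳ; ¬-not; not-injective; ⇔→≡)
open import Data.Fin using (Fin; toℕ) renaming (zero to fzero; suc to fsuc)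
open import Data.Fin.Properties using (toℕ-injective)
open import Data.Product using (_×_; _,_; proj₁; proj₂; ∃-syntax)
open import Data.Sum using (_⊎_; inj₁; inj₂; [_,_])
open import Data.List using (List; []; _∷_; map; length; allFin; filterᵇ; _++_; tabulate)
open import Data.List.Properties using (length-map; map-cong-local)
open import Data.Nat.ListAction using (sum)
open import Data.Bool.ListAction using (any; all)
open import Data.List.Membership.Propositional using (_∈_)
open import Data.List.Membership.Propositional.Properties using (∈-allFin; ∈-map⁻; ∈-++⁺ˡ; ∈-++⁺ʳ; ∈-++⁻)
open import Data.List.Relation.Unary.Any using (here; there)
open import Data.List.Relation.Unary.All as All using (All; []; _∷_)
open import Data.List.Relation.Unary.AllPairs using (AllPairs; []; _∷_)
open import Data.List.Relation.Binary.Sublist.Propositional using (_⊆_; []; _∷_; _∷ʳ_)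
open import Data.List.Relation.Binary.Sublist.Propositional.Properties using (All-resp-⊆)
open import Data.Maybe using (just; nothing)
open import Data.Empty using (⊥; ⊥-elim)
open import Function using (_∘_; id; mk⇔)
open import Relation.Binary.PropositionalEquality hiding ([_])
open import Relation.Nullary using (¬_)
open import Relation.Binary.Definitions using (tri<; tri≈; tri>)
open import Algebra.Properties.CommutativeSemigroup +-commutativeSemigroup using (x∙yz≈y∙xz)

𝟙 : Bool → ℕ
𝟙 true  = 1
𝟙 false = 0

𝟙≤1 : ∀ b → 𝟙 b ≤ 1
𝟙≤1 true  = s≤s z≤n
𝟙≤1 false = z≤n

𝟙-mono : ∀ {a b} → (a ≡ true → b ≡ true) → 𝟙 a ≤ 𝟙 b
𝟙-mono {true}  h rewrite h refl = s≤s z≤n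
𝟙-mono {false} h = z≤n

∨-introˡ : ∀ {a b} → a ≡ true → (a ∨ b) ≡ true
∨-introˡ refl = refl

∨-introʳ : ∀ a {b} → b ≡ true → (a ∨ b) ≡ true
∨-introʳ true  _    = refl
∨-introʳ false refl = refl

∨-elim : ∀ a {b} → (a ∨ b) ≡ true → a ≡ true ⊎ b ≡ true
∨-elim true  _ = inj₁ refl
∨-elim false p = inj₂ p

∧-intro : ∀ {a b} → a ≡ true → b ≡ true → (a ∧ b) ≡ true
∧-intro refl refl = refl

∧-elimˡ : ∀ a {b} → (a ∧ b) ≡ true → a ≡ true
∧-elimˡ true _ = refl

∧-elimʳ : ∀ a {b} → (a ∧ b) ≡ true → b ≡ true
∧-elimʳ true p = p

true≢false : true ≢ false
true≢false ()

if-true : ∀ {b} (v : ℕ) → b ≡ true → (if b then v else 0) ≡ v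
if-true v refl = refl

if-false : ∀ {b} (v : ℕ) → b ≡ false → (if b then v else 0) ≡ 0
if-false v refl = refl

bool-ext : ∀ {a b} → (a ≡ true → b ≡ true) → (b ≡ true → a ≡ true) → a ≡ b
bool-ext to from = ⇔→≡ (mk⇔ to from)

≡true⇒T : ∀ {b} → b ≡ true → T b
≡true⇒T refl = _

T⇒≡true : ∀ {b} → T b → b ≡ true
T⇒≡true {true} _ = refl

≡ᵇ⇒≡′ : ∀ {m n} → (m ≡ᵇ n) ≡ true → m ≡ n
≡ᵇ⇒≡′ {m} {n} p = ≡ᵇ⇒≡ m n (≡true⇒T p)

≡⇒≡ᵇ′ : ∀ {m n} → m ≡ n → (m ≡ᵇ n) ≡ true
≡⇒≡ᵇ′ {m} {n} p = T⇒≡true (≡⇒≡ᵇ m n p)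

≡ᵇ-refl : ∀ m → (m ≡ᵇ m) ≡ true
≡ᵇ-refl m = ≡⇒≡ᵇ′ (refl {x = m})

≡ᵇ-sym : ∀ m n → (m ≡ᵇ n) ≡ (n ≡ᵇ m)
≡ᵇ-sym zero    zero    = refl
≡ᵇ-sym zero    (suc n) = refl
≡ᵇ-sym (suc m) zero    = refl
≡ᵇ-sym (suc m) (suc n) = ≡ᵇ-sym m n

==⇒≡ : ∀ {n} {x y : Fin n} → (x == y) ≡ true → x ≡ y
==⇒≡ p = toℕ-injective (≡ᵇ⇒≡′ p)

==-refl : ∀ {n} (x : Fin n) → (x == x) ≡ true
==-refl x = ≡ᵇ-refl (toℕ x)

≢⇒==-false : ∀ {n} {x y : Fin n} → x ≢ y → (x == y) ≡ false
≢⇒==-false x≢y = ¬-not (λ p → x≢y (==⇒≡ p))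

==-false⇒≢ : ∀ {n} {x y : Fin n} → (x == y) ≡ false → x ≢ y
==-false⇒≢ {x = x} p refl = true≢false (trans (sym (==-refl x)) p)

==-sym : ∀ {n} (x y : Fin n) → (x == y) ≡ (y == x)
==-sym x y = ≡ᵇ-sym (toℕ x) (toℕ y)

-- Counting

∑ : ∀ {n} → (Fin n → ℕ) → ℕ
∑ {zero}  f = 0
∑ {suc n} f = f fzero + ∑ (f ∘ fsuc)

count : ∀ {n} → (Fin n → Bool) → ℕ
count p = ∑ (𝟙 ∘ p)

∑-cong : ∀ {n} {f g : Fin n → ℕ} → (∀ x → f x ≡ g x) → ∑ f ≡ ∑ g
∑-cong {zero}  e = refl
∑-cong {suc n} e = cong₂ _+_ (e fzero) (∑-cong (e ∘ fsuc))

∑-mono : ∀ {n} {f g : Fin n → ℕ} → (∀ x → f x ≤ g x) → ∑ f ≤ ∑ g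
∑-mono {zero}  e = z≤n
∑-mono {suc n} e = +-mono-≤ (e fzero) (∑-mono (e ∘ fsuc))

∑-zero : ∀ {n} {f : Fin n → ℕ} → (∀ x → f x ≡ 0) → ∑ f ≡ 0
∑-zero {zero}  h = refl
∑-zero {suc n} h = cong₂ _+_ (h fzero) (∑-zero (h ∘ fsuc))

∑-remove : ∀ {n} (f : Fin n → ℕ) (a : Fin n) →
  ∑ f ≡ f a + ∑ (λ x → if x == a then 0 else f x)
∑-remove {suc n} f fzero    = refl
∑-remove {suc n} f (fsuc a) = begin
  f fzero + ∑ (f ∘ fsuc)
    ≡⟨ cong (f fzero +_) (∑-remove (f ∘ fsuc) a) ⟩
  f fzero + (f (fsuc a) + ∑ (λ x → if x == a then 0 else f (fsuc x)))
    ≡⟨ x∙yz≈y∙xz (f fzero) (f (fsuc a)) _ ⟩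
  f (fsuc a) + (f fzero + ∑ (λ x → if x == a then 0 else f (fsuc x))) ∎
  where
  open ≡-Reasoning

∑-supported-at : ∀ {n} (f : Fin n → ℕ) a → (∀ x → x ≢ a → f x ≡ 0) → ∑ f ≡ f a
∑-supported-at f a h = trans (∑-remove f a) (trans (cong (f a +_) (∑-zero off-a)) (+-identityʳ (f a)))
  where
  off-a : ∀ x → (if x == a then 0 else f x) ≡ 0
  off-a x with x == a in x=a
  ... | true  = refl
  ... | false = h x (==-false⇒≢ x=a)

if-==-distinct : ∀ {n} (f : Fin n → ℕ) (a b : Fin n) → a ≢ b → (if b == a then 0 else f b) ≡ f b
if-==-distinct f a b a≢b rewrite ≢⇒==-false (λ b≡a → a≢b (sym b≡a)) = refl

∑-supported-at₂ : ∀ {n} (f : Fin n → ℕ) a b → a ≢ b → (∀ x → x ≢ a → x ≢ b → f x ≡ 0) → ∑ f ≡ f a + f b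
∑-supported-at₂ f a b a≢b h =
  trans (∑-remove f a) (cong (f a +_) (trans (∑-supported-at _ b off-ab) (if-==-distinct f a b a≢b)))
  where
  off-ab : ∀ x → x ≢ b → (if x == a then 0 else f x) ≡ 0
  off-ab x x≢b with x == a in x=a
  ... | true  = refl
  ... | false = h x (==-false⇒≢ x=a) x≢b

count-mono : ∀ {n} {p q : Fin n → Bool} → (∀ x → p x ≡ true → q x ≡ true) → count p ≤ count q
count-mono h = ∑-mono (λ x → 𝟙-mono (h x))

count≤n : ∀ {n} (p : Fin n → Bool) → count p ≤ n
count≤n {zero}  p = z≤n
count≤n {suc n} p = +-mono-≤ (𝟙≤1 (p fzero)) (count≤n (p ∘ fsuc))

count-remove : ∀ {n} (p : Fin n → Bool) (a : Fin n) →
  count p ≡ 𝟙 (p a) + count (λ x → not (x == a) ∧ p x)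
count-remove p a = trans (∑-remove (𝟙 ∘ p) a) (cong (𝟙 (p a) +_) (∑-cong (λ x → if-as-∧ (x == a))))
  where
  if-as-∧ : ∀ {x} b → (if b then 0 else 𝟙 (p x)) ≡ 𝟙 (not b ∧ p x)
  if-as-∧ true  = refl
  if-as-∧ false = refl

≢⇒not-== : ∀ {n} {a b : Fin n} → a ≢ b → not (b == a) ≡ true
≢⇒not-== a≢b = cong not (≢⇒==-false (λ b≡a → a≢b (sym b≡a)))

count≥1 : ∀ {n} (p : Fin n → Bool) a → p a ≡ true → 1 ≤ count p
count≥1 p a pa rewrite count-remove p a | pa = s≤s z≤n

count≥2 : ∀ {n} (p : Fin n → Bool) a b → a ≢ b → p a ≡ true → p b ≡ true → 2 ≤ count p
count≥2 p a b a≢b pa pb rewrite count-remove p a | pa =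
  s≤s (count≥1 _ b (∧-intro (≢⇒not-== a≢b) pb))

count≥3 : ∀ {n} (p : Fin n → Bool) a b c → a ≢ b → a ≢ c → b ≢ c →
  p a ≡ true → p b ≡ true → p c ≡ true → 3 ≤ count p
count≥3 p a b c a≢b a≢c b≢c pa pb pc rewrite count-remove p a | pa =
  s≤s (count≥2 _ b c b≢c (∧-intro (≢⇒not-== a≢b) pb) (∧-intro (≢⇒not-== a≢c) pc))

count-strict : ∀ {n} {p q : Fin n → Bool} → (∀ x → p x ≡ true → q x ≡ true) →
  ∀ a → p a ≡ false → q a ≡ true → suc (count p) ≤ count q
count-strict {p = p} {q} p⊆q a pa qa rewrite count-remove p a | count-remove q a | pa | qa =
  s≤s (count-mono (λ x r → ∧-intro (∧-elimˡ (not (x == a)) r) (p⊆q x (∧-elimʳ (not (x == a)) r))))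

countᵇ : ∀ {A : Set} → (A → Bool) → List A → ℕ
countᵇ p xs = length (filterᵇ p xs)

countᵇ-∷ : ∀ {A : Set} (p : A → Bool) x xs → countᵇ p (x ∷ xs) ≡ 𝟙 (p x) + countᵇ p xs
countᵇ-∷ p x xs with p x
... | true  = refl
... | false = refl

module _ {A : Set} where

  countᵇ-++ : ∀ (p : A → Bool) xs ys → countᵇ p (xs ++ ys) ≡ countᵇ p xs + countᵇ p ys
  countᵇ-++ p []       ys = refl
  countᵇ-++ p (x ∷ xs) ys rewrite countᵇ-∷ p x (xs ++ ys) | countᵇ-∷ p x xs | countᵇ-++ p xs ys =
    sym (+-assoc (𝟙 (p x)) _ _)

  countᵇ-map : ∀ {B : Set} (p : B → Bool) (f : A → B) xs → countᵇ p (map f xs) ≡ countᵇ (p ∘ f) xs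
  countᵇ-map p f []       = refl
  countᵇ-map p f (x ∷ xs) rewrite countᵇ-∷ p (f x) (map f xs) | countᵇ-∷ (p ∘ f) x xs =
    cong (𝟙 (p (f x)) +_) (countᵇ-map p f xs)

  countᵇ-filterᵇ : ∀ (p q : A → Bool) xs → countᵇ p (filterᵇ q xs) ≡ countᵇ (λ x → q x ∧ p x) xs
  countᵇ-filterᵇ p q []       = refl
  countᵇ-filterᵇ p q (x ∷ xs) rewrite countᵇ-∷ (λ x → q x ∧ p x) x xs with q x
  ... | true  = trans (countᵇ-∷ p x _) (cong (𝟙 (p x) +_) (countᵇ-filterᵇ p q xs))
  ... | false = countᵇ-filterᵇ p q xs

  countᵇ-cong : ∀ {p q : A → Bool} xs → (∀ x → x ∈ xs → p x ≡ q x) → countᵇ p xs ≡ countᵇ q xs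
  countᵇ-cong {p} {q} []       h = refl
  countᵇ-cong {p} {q} (x ∷ xs) h rewrite countᵇ-∷ p x xs | countᵇ-∷ q x xs | h x (here refl) =
    cong (𝟙 (q x) +_) (countᵇ-cong xs (λ y m → h y (there m)))

  countᵇ-zero : ∀ (p : A → Bool) xs → (∀ x → x ∈ xs → p x ≡ false) → countᵇ p xs ≡ 0
  countᵇ-zero p []       h = refl
  countᵇ-zero p (x ∷ xs) h rewrite countᵇ-∷ p x xs | h x (here refl) = countᵇ-zero p xs (λ y m → h y (there m))

  countᵇ-pos : ∀ (p : A → Bool) xs → 1 ≤ countᵇ p xs → ∃[ x ] (x ∈ xs × p x ≡ true)
  countᵇ-pos p (x ∷ xs) h rewrite countᵇ-∷ p x xs with p x in px
  ... | true  = x , here refl , px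
  ... | false with countᵇ-pos p xs h
  ...   | y , y∈xs , py = y , there y∈xs , py

  countᵇ-tabulate : ∀ {n} (p : A → Bool) (f : Fin n → A) → countᵇ p (tabulate f) ≡ count (p ∘ f)
  countᵇ-tabulate {zero}  p f = refl
  countᵇ-tabulate {suc n} p f =
    trans (countᵇ-∷ p (f fzero) _) (cong (𝟙 (p (f fzero)) +_) (countᵇ-tabulate p (f ∘ fsuc)))

  sum-filterᵇ-tabulate : ∀ {n} (p : A → Bool) (ω : A → ℕ) (f : Fin n → A) →
    sum (map ω (filterᵇ p (tabulate f))) ≡ ∑ (λ x → if p (f x) then ω (f x) else 0)
  sum-filterᵇ-tabulate {zero}  p ω f = refl
  sum-filterᵇ-tabulate {suc n} p ω f with p (f fzero)
  ... | true  = cong (ω (f fzero) +_) (sum-filterᵇ-tabulate p ω (f ∘ fsuc))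
  ... | false = sum-filterᵇ-tabulate p ω (f ∘ fsuc)

  any-intro : ∀ (q : A → Bool) {x xs} → x ∈ xs → q x ≡ true → any q xs ≡ true
  any-intro q (here refl) qx = ∨-introˡ qx
  any-intro q {xs = y ∷ ys} (there x∈ys) qx = ∨-introʳ (q y) (any-intro q x∈ys qx)

  any-elim : ∀ (q : A → Bool) xs → any q xs ≡ true → ∃[ x ] (x ∈ xs × q x ≡ true)
  any-elim q (y ∷ ys) h with ∨-elim (q y) h
  ... | inj₁ qy = y , here refl , qy
  ... | inj₂ qys with any-elim q ys qys
  ...   | x , x∈ys , qx = x , there x∈ys , qx

  any-false : ∀ (q : A → Bool) {x xs} → any q xs ≡ false → x ∈ xs → q x ≡ false
  any-false q h x∈xs = ¬-not (λ qx → true≢false (trans (sym (any-intro q x∈xs qx)) h))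

  any-cong : ∀ {f g : A → Bool} xs → (∀ x → f x ≡ g x) → any f xs ≡ any g xs
  any-cong []       h = refl
  any-cong (x ∷ xs) h = cong₂ _∨_ (h x) (any-cong xs h)

  all-elim : ∀ (q : A → Bool) {x xs} → all q xs ≡ true → x ∈ xs → q x ≡ true
  all-elim q {xs = y ∷ ys} h (here refl) = ∧-elimˡ (q y) h
  all-elim q {xs = y ∷ ys} h (there x∈ys) = all-elim q (∧-elimʳ (q y) h) x∈ys

  all-intro : ∀ (q : A → Bool) xs → (∀ x → x ∈ xs → q x ≡ true) → all q xs ≡ true
  all-intro q []       h = refl
  all-intro q (y ∷ ys) h = ∧-intro (h y (here refl)) (all-intro q ys (λ x m → h x (there m)))

  all-false : ∀ (q : A → Bool) xs → all q xs ≡ false → ∃[ x ] (x ∈ xs × q x ≡ false)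
  all-false q (y ∷ ys) h with q y in qy
  ... | false = y , here refl , qy
  ... | true with all-false q ys h
  ...   | x , x∈ys , qx = x , there x∈ys , qx

-- Edges and connectivity

module _ {n : ℕ} where

  isEndpoint : Edge n → Fin n → Bool
  isEndpoint (a , b) x = (a == x) ∨ (b == x)

  covered : List (Edge n) → Fin n → Bool
  covered A x = any (λ e → isEndpoint e x) A

  links : Edge n → Fin n → Fin n → Bool
  links (a , b) x y = ((a == x) ∧ (b == y)) ∨ ((b == x) ∧ (a == y))

  endpoints : List (Edge n) → List (Fin n)
  endpoints []            = []
  endpoints ((a , b) ∷ A) = a ∷ b ∷ endpoints A

  isEndpoint-elim : ∀ e x → isEndpoint e x ≡ true → proj₁ e ≡ x ⊎ proj₂ e ≡ x
  isEndpoint-elim (a , b) x h with ∨-elim (a == x) h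
  ... | inj₁ p = inj₁ (==⇒≡ p)
  ... | inj₂ p = inj₂ (==⇒≡ p)

  isEndpoint₁ : ∀ e → isEndpoint e (proj₁ e) ≡ true
  isEndpoint₁ (a , b) = ∨-introˡ (==-refl a)

  isEndpoint₂ : ∀ e → isEndpoint e (proj₂ e) ≡ true
  isEndpoint₂ (a , b) = ∨-introʳ (a == b) (==-refl b)

  links-elim : ∀ e x y → links e x y ≡ true → (proj₁ e ≡ x × proj₂ e ≡ y) ⊎ (proj₂ e ≡ x × proj₁ e ≡ y)
  links-elim (a , b) x y h with ∨-elim ((a == x) ∧ (b == y)) h
  ... | inj₁ p = inj₁ (==⇒≡ (∧-elimˡ (a == x) p) , ==⇒≡ (∧-elimʳ (a == x) p))
  ... | inj₂ p = inj₂ (==⇒≡ (∧-elimˡ (b == x) p) , ==⇒≡ (∧-elimʳ (b == x) p))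

  links₁₂ : ∀ e → links e (proj₁ e) (proj₂ e) ≡ true
  links₁₂ (a , b) = ∨-introˡ (∧-intro (==-refl a) (==-refl b))

  links₂₁ : ∀ e → links e (proj₂ e) (proj₁ e) ≡ true
  links₂₁ (a , b) = ∨-introʳ ((a == b) ∧ (b == a)) (∧-intro (==-refl b) (==-refl a))

  links⇒isEndpointˡ : ∀ e x y → links e x y ≡ true → isEndpoint e x ≡ true
  links⇒isEndpointˡ e x y h with links-elim e x y h
  ... | inj₁ (refl , _) = isEndpoint₁ e
  ... | inj₂ (refl , _) = isEndpoint₂ e

  links⇒isEndpointʳ : ∀ e x y → links e x y ≡ true → isEndpoint e y ≡ true
  links⇒isEndpointʳ e x y h with links-elim e x y h
  ... | inj₁ (_ , refl) = isEndpoint₂ e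
  ... | inj₂ (_ , refl) = isEndpoint₁ e

  isEndpoint⇒links : ∀ e x → isEndpoint e x ≡ true → ∃[ y ] (links e x y ≡ true)
  isEndpoint⇒links e x h with isEndpoint-elim e x h
  ... | inj₁ refl = proj₂ e , links₁₂ e
  ... | inj₂ refl = proj₁ e , links₂₁ e

  disjoint⇒¬common : ∀ e f → disjointEdges e f ≡ true → ∀ v → isEndpoint e v ≡ true → isEndpoint f v ≡ true → ⊥
  disjoint⇒¬common (a , b) (c , d) h v ev fv =
    true≢false (trans (sym (common (isEndpoint-elim (a , b) v ev) (isEndpoint-elim (c , d) v fv))) (not-injective h))
    where
    common : a ≡ v ⊎ b ≡ v → c ≡ v ⊎ d ≡ v → ((a == c) ∨ (a == d) ∨ (b == c) ∨ (b == d)) ≡ true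
    common (inj₁ refl) (inj₁ refl) = ∨-introˡ (==-refl a)
    common (inj₁ refl) (inj₂ refl) = ∨-introʳ (a == c) (∨-introˡ (==-refl a))
    common (inj₂ refl) (inj₁ refl) = ∨-introʳ (a == c) (∨-introʳ (a == d) (∨-introˡ (==-refl b)))
    common (inj₂ refl) (inj₂ refl) = ∨-introʳ (a == c) (∨-introʳ (a == d) (∨-introʳ (b == c) (==-refl b)))

  ≡⇒isEndpoint₁ : ∀ e {v} → v ≡ proj₁ e → isEndpoint e v ≡ true
  ≡⇒isEndpoint₁ e refl = isEndpoint₁ e

  ≡⇒isEndpoint₂ : ∀ e {v} → v ≡ proj₂ e → isEndpoint e v ≡ true
  ≡⇒isEndpoint₂ e refl = isEndpoint₂ e

  ¬disjoint⇒common : ∀ e f → disjointEdges e f ≡ false → ∃[ v ] (isEndpoint e v ≡ true × isEndpoint f v ≡ true)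
  ¬disjoint⇒common (a , b) (c , d) h with a == c in ac | a == d in ad | b == c in bc | b == d in bd
  ... | true  | _     | _     | _    = a , isEndpoint₁ (a , b) , ≡⇒isEndpoint₁ (c , d) (==⇒≡ ac)
  ... | false | true  | _     | _    = a , isEndpoint₁ (a , b) , ≡⇒isEndpoint₂ (c , d) (==⇒≡ ad)
  ... | false | false | true  | _    = b , isEndpoint₂ (a , b) , ≡⇒isEndpoint₁ (c , d) (==⇒≡ bc)
  ... | false | false | false | true = b , isEndpoint₂ (a , b) , ≡⇒isEndpoint₂ (c , d) (==⇒≡ bd)

  links⇒≢ : ∀ {e} → proj₁ e ≢ proj₂ e → ∀ {x y} → links e x y ≡ true → x ≢ y
  links⇒≢ {e} e₁≢e₂ {x} {y} h with links-elim e x y h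
  ... | inj₁ (refl , refl) = e₁≢e₂
  ... | inj₂ (refl , refl) = e₁≢e₂ ∘ sym

module Connectivity {n : ℕ} (A : List (Edge n)) where

  Reach : ℕ → Fin n → Fin n → Bool
  Reach k = reachStep k A

  data LastStep (u : Fin n) (k : ℕ) : Fin n → Set where
    stay : ∀ {v} → Reach k u v ≡ true → LastStep u k v
    fwd  : ∀ {e} → e ∈ A → Reach k u (proj₁ e) ≡ true → LastStep u k (proj₂ e)
    bwd  : ∀ {e} → e ∈ A → Reach k u (proj₂ e) ≡ true → LastStep u k (proj₁ e)

  lastStep⇒reach : ∀ {u k v} → LastStep u k v → Reach (suc k) u v ≡ true
  lastStep⇒reach (stay p) = ∨-introˡ p
  lastStep⇒reach {u} {k} (fwd {e} e∈A p) = ∨-introʳ (Reach k u (proj₂ e))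
    (any-intro _ e∈A (∨-introˡ (∧-intro p (==-refl (proj₂ e)))))
  lastStep⇒reach {u} {k} (bwd {e} e∈A p) = ∨-introʳ (Reach k u (proj₁ e))
    (any-intro _ e∈A (∨-introʳ (Reach k u (proj₁ e) ∧ (proj₂ e == proj₁ e)) (∧-intro p (==-refl (proj₁ e)))))

  reach⇒lastStep : ∀ {u k v} → Reach (suc k) u v ≡ true → LastStep u k v
  reach⇒lastStep {u} {k} {v} h with ∨-elim (Reach k u v) h
  ... | inj₁ p = stay p
  ... | inj₂ p with any-elim _ A p
  ...   | e , e∈A , q with ∨-elim (Reach k u (proj₁ e) ∧ (proj₂ e == v)) q
  ...     | inj₁ q₁ = subst (LastStep u k) (==⇒≡ (∧-elimʳ (Reach k u (proj₁ e)) q₁))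
                        (fwd e∈A (∧-elimˡ (Reach k u (proj₁ e)) q₁))
  ...     | inj₂ q₂ = subst (LastStep u k) (==⇒≡ (∧-elimʳ (Reach k u (proj₂ e)) q₂))
                        (bwd e∈A (∧-elimˡ (Reach k u (proj₂ e)) q₂))

  reach-suc : ∀ k {u v} → Reach k u v ≡ true → Reach (suc k) u v ≡ true
  reach-suc k p = lastStep⇒reach {k = k} (stay p)

  reach-refl : ∀ k u → Reach k u u ≡ true
  reach-refl zero    u = ==-refl u
  reach-refl (suc k) u = reach-suc k (reach-refl k u)

  reach-edge : ∀ {e} → e ∈ A → Reach 1 (proj₁ e) (proj₂ e) ≡ true
  reach-edge {e} e∈A = lastStep⇒reach {proj₁ e} {0} (fwd e∈A (==-refl (proj₁ e)))

  reach-edge⁻¹ : ∀ {e} → e ∈ A → Reach 1 (proj₂ e) (proj₁ e) ≡ true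
  reach-edge⁻¹ {e} e∈A = lastStep⇒reach {proj₂ e} {0} (bwd e∈A (==-refl (proj₂ e)))

  reach-+ : ∀ j k {u x v} → Reach j u x ≡ true → Reach k x v ≡ true → Reach (j + k) u v ≡ true
  reach-+ j zero    {u} {x} {v} h₁ h₂ rewrite +-identityʳ j =
    subst (λ y → Reach j u y ≡ true) (==⇒≡ {x = x} {v} h₂) h₁
  reach-+ j (suc k) {u} {x} h₁ h₂ rewrite +-suc j k with reach⇒lastStep {x} {k} h₂
  ... | stay p    = reach-suc (j + k) (reach-+ j k {u} {x} h₁ p)
  ... | fwd e∈A p = lastStep⇒reach {u} {j + k} (fwd e∈A (reach-+ j k {u} {x} h₁ p))
  ... | bwd e∈A p = lastStep⇒reach {u} {j + k} (bwd e∈A (reach-+ j k {u} {x} h₁ p))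

  reach-sym : ∀ k {u v} → Reach k u v ≡ true → Reach k v u ≡ true
  reach-sym zero    {u} {v} h = trans (==-sym v u) h
  reach-sym (suc k) {u} h with reach⇒lastStep {u} {k} h
  ... | stay p        = reach-suc k (reach-sym k p)
  ... | fwd {e} e∈A p = reach-+ 1 k {x = proj₁ e} (reach-edge⁻¹ e∈A) (reach-sym k p)
  ... | bwd {e} e∈A p = reach-+ 1 k {x = proj₂ e} (reach-edge e∈A) (reach-sym k p)

  reach-suc-cong : ∀ {k j u} → (∀ y → Reach k u y ≡ Reach j u y) → ∀ y → Reach (suc k) u y ≡ Reach (suc j) u y
  reach-suc-cong h y = cong₂ _∨_ (h y) (any-cong A (λ e →
    cong₂ _∨_ (cong (_∧ (proj₂ e == y)) (h (proj₁ e))) (cong (_∧ (proj₁ e == y)) (h (proj₂ e)))))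

  Stable : ℕ → Fin n → Set
  Stable k u = ∀ j y → Reach (k + j) u y ≡ Reach k u y

  stable-suc : ∀ {k u} → Stable k u → Stable (suc k) u
  stable-suc {k} {u} st j y = begin
    Reach (suc k + j) u y  ≡⟨ cong (λ i → Reach i u y) (sym (+-suc k j)) ⟩
    Reach (k + suc j) u y  ≡⟨ st (suc j) y ⟩
    Reach k u y            ≡⟨ sym (st 1 y) ⟩
    Reach (k + 1) u y      ≡⟨ cong (λ i → Reach i u y) (+-comm k 1) ⟩
    Reach (suc k) u y      ∎
    where open ≡-Reasoning

  no-growth⇒stable : ∀ {k u} → (∀ y → Reach (suc k) u y ≡ Reach k u y) → Stable k u
  no-growth⇒stable {k} {u} h zero    y = cong (λ i → Reach i u y) (+-identityʳ k)
  no-growth⇒stable {k} {u} h (suc j) y rewrite +-suc k j =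
    trans (reach-suc-cong {k + j} {k} (no-growth⇒stable {k} {u} h j) y) (h y)

  -- Until the ball of radius k around u stops growing it has more than k points.
  grows-or-stable : ∀ k u → suc k ≤ count (Reach k u) ⊎ Stable k u
  grows-or-stable zero    u = inj₁ (count≥1 (Reach 0 u) u (reach-refl 0 u))
  grows-or-stable (suc k) u with grows-or-stable k u
  ... | inj₂ st  = inj₂ (stable-suc {k} st)
  ... | inj₁ big with any (λ y → Reach (suc k) u y ∧ not (Reach k u y)) (allFin n) in grew
  ...   | true with any-elim _ (allFin n) grew
  ...     | y , _ , new = inj₁ (≤-trans (s≤s big) (count-strict (λ _ → reach-suc k) y
                  (not-injective (∧-elimʳ (Reach (suc k) u y) new)) (∧-elimˡ (Reach (suc k) u y) new)))
  grows-or-stable (suc k) u | inj₁ big | false = inj₂ (stable-suc {k} (no-growth⇒stable {k} no-new))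
    where
    no-new : ∀ y → Reach (suc k) u y ≡ Reach k u y
    no-new y = bool-ext old (reach-suc k)
      where
      old : Reach (suc k) u y ≡ true → Reach k u y ≡ true
      old p = not-injective (trans (cong (_∧ not (Reach k u y)) (sym p)) (any-false _ grew (∈-allFin y)))

  stable-at-n : ∀ u → Stable n u
  stable-at-n u with grows-or-stable n u
  ... | inj₂ st  = st
  ... | inj₁ big = ⊥-elim (<-irrefl refl (≤-trans big (count≤n (Reach n u))))

  connected-refl : ∀ u → connected A u u ≡ true
  connected-refl = reach-refl n

  connected-sym : ∀ {u v} → connected A u v ≡ true → connected A v u ≡ true
  connected-sym = reach-sym n

  connected-trans : ∀ {u x v} → connected A u x ≡ true → connected A x v ≡ true → connected A u v ≡ true
  connected-trans {u} {x} {v} h₁ h₂ = trans (sym (stable-at-n u n v)) (reach-+ n n h₁ h₂)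

  connected-edge : ∀ {e} → e ∈ A → connected A (proj₁ e) (proj₂ e) ≡ true
  connected-edge {e} e∈A =
    trans (sym (stable-at-n (proj₁ e) 1 (proj₂ e))) (reach-+ n 1 (reach-refl n (proj₁ e)) (reach-edge e∈A))

-- Components

dotSum-vertices : ∀ {X : Set} (ω : X → ℕ) (vs : List X) →
  dotSum (map (λ v → (ω v , 0)) vs) ≡ (sum (map ω vs) , length vs ∸ 1)
dotSum-vertices ω []           = refl
dotSum-vertices ω (v ∷ [])     = cong (_, 0) (sym (+-identityʳ (ω v)))
dotSum-vertices ω (v ∷ v′ ∷ vs) rewrite dotSum-vertices ω (v′ ∷ vs) =
  cong (ω v + (ω v′ + sum (map ω vs)) ,_) (+-comm (length vs) 1)

module Components {n : ℕ} (A : List (Edge n)) where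
  open Connectivity A public

  isRep⇒minimal : ∀ {r} → isRep A r ≡ true → ∀ u → toℕ u < toℕ r → connected A u r ≡ false
  isRep⇒minimal {r} h u u<r with all-elim (λ u → not ((toℕ u <ᵇ toℕ r) ∧ connected A u r)) h (∈-allFin u)
  ... | q rewrite T⇒≡true (<⇒<ᵇ u<r) = not-injective q

  minimal⇒isRep : ∀ {r} → (∀ u → toℕ u < toℕ r → connected A u r ≡ false) → isRep A r ≡ true
  minimal⇒isRep {r} h = all-intro _ (allFin n) (λ u _ → minimal u)
    where
    minimal : ∀ u → not ((toℕ u <ᵇ toℕ r) ∧ connected A u r) ≡ true
    minimal u with toℕ u <ᵇ toℕ r in u<r
    ... | false = refl
    ... | true rewrite h u (<ᵇ⇒< (toℕ u) (toℕ r) (≡true⇒T u<r)) = refl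

  rep-exists-below : ∀ bound x → toℕ x < bound → ∃[ r ] (isRep A r ≡ true × connected A r x ≡ true)
  rep-exists-below (suc bound) x x<bound with isRep A x in rep
  ... | true  = x , rep , connected-refl x
  ... | false with all-false (λ u → not ((toℕ u <ᵇ toℕ x) ∧ connected A u x)) (allFin n) rep
  ...   | u , _ , q with not-injective {y = true} q
  ...     | u<x∧u~x with rep-exists-below bound u
                         (≤-trans (<ᵇ⇒< _ _ (≡true⇒T (∧-elimˡ (toℕ u <ᵇ toℕ x) u<x∧u~x))) (≤-pred x<bound))
  ...       | r , r-rep , r~u = r , r-rep , connected-trans r~u (∧-elimʳ (toℕ u <ᵇ toℕ x) u<x∧u~x)

  rep-exists : ∀ x → ∃[ r ] (isRep A r ≡ true × connected A r x ≡ true)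
  rep-exists x = rep-exists-below (suc (toℕ x)) x ≤-refl

  links⇒connected : ∀ {e} → e ∈ A → ∀ {x y} → links e x y ≡ true → connected A x y ≡ true
  links⇒connected {e} e∈A {x} {y} h with links-elim e x y h
  ... | inj₁ (refl , refl) = connected-edge e∈A
  ... | inj₂ (refl , refl) = connected-sym (connected-edge e∈A)

  componentSize : Fin n → ℕ
  componentSize r = count (connected A r)

  compMark≡ : ∀ (ω : Fin n → ℕ) r →
    compMark ω A r ≡ (∑ (λ x → if connected A r x then ω x else 0) , componentSize r ∸ 1)
  compMark≡ ω r = trans (dotSum-vertices ω (component A r))
    (cong₂ _,_ (sum-filterᵇ-tabulate (connected A r) ω id) (cong (_∸ 1) (countᵇ-tabulate (connected A r) id)))

-- Multisets of natural numbers

mult : ℕ → List ℕ → ℕ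
mult w []      = 0
mult w (x ∷ l) = 𝟙 (w ≡ᵇ x) + mult w l

infix 4 _≈ₘ_

record _≈ₘ_ (l k : List ℕ) : Set where
  constructor mult-≡
  field same-mult : ∀ w → mult w l ≡ mult w k
open _≈ₘ_

mult-++ : ∀ w l k → mult w (l ++ k) ≡ mult w l + mult w k
mult-++ w []      k = refl
mult-++ w (x ∷ l) k = trans (cong (𝟙 (w ≡ᵇ x) +_) (mult-++ w l k)) (sym (+-assoc (𝟙 (w ≡ᵇ x)) _ _))

mult-head : ∀ x l → 1 ≤ mult x (x ∷ l)
mult-head x l rewrite ≡ᵇ-refl x = s≤s z≤n

mult-pos⇒∈ : ∀ x k → 1 ≤ mult x k → ∃[ y ] (y ∈ k × x ≡ y)
mult-pos⇒∈ x (y ∷ k) h with x ≡ᵇ y in x=y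
... | true  = y , here refl , ≡ᵇ⇒≡′ x=y
... | false with mult-pos⇒∈ x k h
...   | z , z∈k , x≡z = z , there z∈k , x≡z

≈ₘ-refl : ∀ {l} → l ≈ₘ l
≈ₘ-refl = mult-≡ (λ w → refl)

≈ₘ-reflexive : ∀ {l k} → l ≡ k → l ≈ₘ k
≈ₘ-reflexive refl = ≈ₘ-refl

≈ₘ-sym : ∀ {l k} → l ≈ₘ k → k ≈ₘ l
≈ₘ-sym h = mult-≡ (λ w → sym (same-mult h w))

≈ₘ-trans : ∀ {l k j} → l ≈ₘ k → k ≈ₘ j → l ≈ₘ j
≈ₘ-trans h₁ h₂ = mult-≡ (λ w → trans (same-mult h₁ w) (same-mult h₂ w))

≈ₘ-++ : ∀ {l k l′ k′} → l ≈ₘ l′ → k ≈ₘ k′ → l ++ k ≈ₘ l′ ++ k′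
≈ₘ-++ {l} {k} {l′} {k′} h₁ h₂ = mult-≡ λ w →
  trans (mult-++ w l k) (trans (cong₂ _+_ (same-mult h₁ w) (same-mult h₂ w)) (sym (mult-++ w l′ k′)))

≈ₘ-∷ : ∀ x {l k} → l ≈ₘ k → x ∷ l ≈ₘ x ∷ k
≈ₘ-∷ x = ≈ₘ-++ (≈ₘ-refl {x ∷ []})

≈ₘ-cancelˡ : ∀ {l k l′ k′} → l ++ k ≈ₘ l′ ++ k′ → l ≈ₘ l′ → k ≈ₘ k′
≈ₘ-cancelˡ {l} {k} {l′} {k′} h₁ h₂ = mult-≡ λ w → +-cancelˡ-≡ (mult w l) _ _
  (trans (sym (mult-++ w l k))
         (trans (same-mult h₁ w) (trans (mult-++ w l′ k′) (cong (_+ mult w k′) (sym (same-mult h₂ w))))))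

≈ₘ-cancelʳ : ∀ {l k} R → l ++ R ≈ₘ k ++ R → l ≈ₘ k
≈ₘ-cancelʳ {l} {k} R h = mult-≡ λ w → +-cancelʳ-≡ (mult w R) _ _
  (trans (sym (mult-++ w l R)) (trans (same-mult h w) (mult-++ w k R)))

≈ₘ-∷-cancel : ∀ {x l k} → x ∷ l ≈ₘ x ∷ k → l ≈ₘ k
≈ₘ-∷-cancel {x} h = ≈ₘ-cancelˡ {x ∷ []} {l′ = x ∷ []} h ≈ₘ-refl

≈ₘ-swap : ∀ u v l → u ∷ v ∷ l ≈ₘ v ∷ u ∷ l
≈ₘ-swap u v l = mult-≡ (λ w → x∙yz≈y∙xz (𝟙 (w ≡ᵇ u)) (𝟙 (w ≡ᵇ v)) (mult w l))

≈ₘ-head-∈ : ∀ {x l k} → x ∷ l ≈ₘ k → ∃[ y ] (y ∈ k × x ≡ y)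
≈ₘ-head-∈ {x} {l} {k} h = mult-pos⇒∈ x k (subst (1 ≤_) (same-mult h x) (mult-head x l))

≈ₘ-singleton : ∀ {x y} → x ∷ [] ≈ₘ y ∷ [] → x ≡ y
≈ₘ-singleton h with ≈ₘ-head-∈ h
... | _ , here refl , x≡y = x≡y
... | _ , there () , _

≈ₘ-pair⁻ : ∀ {x y u v} → x ∷ y ∷ [] ≈ₘ u ∷ v ∷ [] → (x ≡ u × y ≡ v) ⊎ (x ≡ v × y ≡ u)
≈ₘ-pair⁻ {x} {y} {u} {v} h with ≈ₘ-head-∈ h
... | _ , here refl , refl = inj₁ (refl , ≈ₘ-singleton (≈ₘ-∷-cancel h))
... | _ , there (here refl) , refl = inj₂ (refl , ≈ₘ-singleton (≈ₘ-∷-cancel (≈ₘ-trans h (≈ₘ-swap u x []))))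
... | _ , there (there ()) , _

≈ₘ-pair⁺ : ∀ {x y u v} → (x ≡ u × y ≡ v) ⊎ (x ≡ v × y ≡ u) → x ∷ y ∷ [] ≈ₘ u ∷ v ∷ []
≈ₘ-pair⁺ (inj₁ (refl , refl)) = ≈ₘ-refl
≈ₘ-pair⁺ {x} {y} (inj₂ (refl , refl)) = ≈ₘ-swap x y []

≈ₘ-pair⇒sum : ∀ {x y u v} → x ∷ y ∷ [] ≈ₘ u ∷ v ∷ [] → x + y ≡ u + v
≈ₘ-pair⇒sum {x} {y} h with ≈ₘ-pair⁻ h
... | inj₁ (refl , refl) = refl
... | inj₂ (refl , refl) = +-comm x y

removeOne-just : ∀ x L {L′} → removeOne x L ≡ just L′ → L ≈ₘ x ∷ L′
removeOne-just x L h = mult-≡ (mult-removeOne x L h)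
  where
  mult-removeOne : ∀ x L {L′} → removeOne x L ≡ just L′ → ∀ w → mult w L ≡ mult w (x ∷ L′)
  mult-removeOne x (y ∷ ys) h w with x ≡ᵇ y in x=y
  mult-removeOne x (y ∷ ys) refl w | true = cong (λ z → 𝟙 (w ≡ᵇ z) + mult w ys) (sym (≡ᵇ⇒≡′ x=y))
  ... | false with removeOne x ys in rest
  mult-removeOne x (y ∷ ys) refl w | false | just L″ =
    trans (cong (𝟙 (w ≡ᵇ y) +_) (mult-removeOne x ys rest w)) (x∙yz≈y∙xz (𝟙 (w ≡ᵇ y)) (𝟙 (w ≡ᵇ x)) (mult w L″))

removeOne-length : ∀ x L {L′} → removeOne x L ≡ just L′ → length L ≡ suc (length L′)
removeOne-length x (y ∷ ys) h with x ≡ᵇ y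
removeOne-length x (y ∷ ys) refl | true = refl
... | false with removeOne x ys in rest
removeOne-length x (y ∷ ys) refl | false | just L″ = cong suc (removeOne-length x ys rest)

removeOne-nothing : ∀ x L → removeOne x L ≡ nothing → mult x L ≡ 0
removeOne-nothing x []       h = refl
removeOne-nothing x (y ∷ ys) h with x ≡ᵇ y in x=y
removeOne-nothing x (y ∷ ys) () | true
... | false with removeOne x ys in rest
...   | nothing = removeOne-nothing x ys rest

≈ₘ-length : ∀ l k → l ≈ₘ k → length l ≡ length k
≈ₘ-length []      []      h = refl
≈ₘ-length []      (y ∷ k) h = ⊥-elim (<-irrefl refl (subst (1 ≤_) (sym (same-mult h y)) (mult-head y k)))
≈ₘ-length (x ∷ l) k       h with removeOne x k in rm
... | nothing =
  ⊥-elim (<-irrefl refl (subst (1 ≤_) (trans (same-mult h x) (removeOne-nothing x k rm)) (mult-head x l)))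
... | just k′ = trans (cong suc (≈ₘ-length l k′ (≈ₘ-∷-cancel (≈ₘ-trans h (removeOne-just x k rm)))))
                      (sym (removeOne-length x k rm))

removeAll-just : ∀ xs L {R} → removeAll xs L ≡ just R → L ≈ₘ xs ++ R
removeAll-just []       L refl = ≈ₘ-refl
removeAll-just (x ∷ xs) L h with removeOne x L in rm
... | just L′ = ≈ₘ-trans (removeOne-just x L rm) (≈ₘ-∷ x (removeAll-just xs L′ h))

removeAll-nothing : ∀ xs L → removeAll xs L ≡ nothing → ∃[ w ] (mult w L < mult w xs)
removeAll-nothing (x ∷ xs) L h with removeOne x L in rm
... | nothing = x , subst (_< mult x (x ∷ xs)) (sym (removeOne-nothing x L rm)) (mult-head x xs)
... | just L′ with removeAll-nothing xs L′ h
...   | w , lt =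
  w , subst (_< mult w (x ∷ xs)) (sym (same-mult (removeOne-just x L rm) w)) (+-monoʳ-< (𝟙 (w ≡ᵇ x)) lt)

≈ₘ-split-by-sum : ∀ {x y z t w₀ w₁ w₂} → x ∷ y ∷ z ∷ t ∷ [] ≈ₘ w₀ ∷ w₀ ∷ w₁ ∷ w₂ ∷ [] →
  x + y ≡ w₀ + w₁ → x ∷ y ∷ [] ≈ₘ w₀ ∷ w₁ ∷ [] × z ∷ t ∷ [] ≈ₘ w₀ ∷ w₂ ∷ []
≈ₘ-split-by-sum {x} {y} {z} {t} {w₀} {w₁} {w₂} h x+y = first , ≈ₘ-cancelˡ (≈ₘ-trans h regroup) first
  where
  regroup : w₀ ∷ w₀ ∷ w₁ ∷ w₂ ∷ [] ≈ₘ w₀ ∷ w₁ ∷ w₀ ∷ w₂ ∷ []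
  regroup = ≈ₘ-∷ w₀ (≈ₘ-swap w₀ w₁ _)
  w₂-first : w₀ ∷ w₀ ∷ w₁ ∷ w₂ ∷ [] ≈ₘ w₂ ∷ w₀ ∷ w₀ ∷ w₁ ∷ []
  w₂-first = ≈ₘ-trans (≈ₘ-∷ w₀ (≈ₘ-∷ w₀ (≈ₘ-swap w₁ w₂ [])))
               (≈ₘ-trans (≈ₘ-∷ w₀ (≈ₘ-swap w₀ w₂ _)) (≈ₘ-swap w₀ w₂ _))
  y-with-x≡w₂ : ∃[ q ] (q ∈ w₀ ∷ w₀ ∷ w₁ ∷ [] × y ≡ q) → x ∷ y ∷ [] ≈ₘ w₀ ∷ w₁ ∷ []
  y-with-x≡w₂ (_ , here refl , refl) =
    ≈ₘ-pair⁺ (inj₂ (+-cancelʳ-≡ y x w₁ (trans x+y (+-comm y w₁)) , refl))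
  y-with-x≡w₂ (_ , there (here refl) , refl) =
    ≈ₘ-pair⁺ (inj₂ (+-cancelʳ-≡ y x w₁ (trans x+y (+-comm y w₁)) , refl))
  y-with-x≡w₂ (_ , there (there (here refl)) , refl) =
    ≈ₘ-pair⁺ (inj₁ (+-cancelʳ-≡ y x w₀ x+y , refl))
  first : x ∷ y ∷ [] ≈ₘ w₀ ∷ w₁ ∷ []
  first with ≈ₘ-head-∈ h
  ... | _ , here refl , refl = ≈ₘ-pair⁺ (inj₁ (refl , +-cancelˡ-≡ x _ _ x+y))
  ... | _ , there (here refl) , refl = ≈ₘ-pair⁺ (inj₁ (refl , +-cancelˡ-≡ x _ _ x+y))
  ... | _ , there (there (here refl)) , refl = ≈ₘ-pair⁺ (inj₂ (refl , +-cancelˡ-≡ x _ _ (trans x+y (+-comm w₀ x))))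
  ... | _ , there (there (there (here refl))) , refl = y-with-x≡w₂ (≈ₘ-head-∈ (≈ₘ-∷-cancel (≈ₘ-trans h w₂-first)))

-- Monomials

=ᴹ⇒≡ : ∀ {m m′} → (m =ᴹ m′) ≡ true → m ≡ m′
=ᴹ⇒≡ {a , b} {c , d} h = cong₂ _,_ (≡ᵇ⇒≡′ (∧-elimˡ (a ≡ᵇ c) h)) (≡ᵇ⇒≡′ (∧-elimʳ (a ≡ᵇ c) h))

=ᴹ-refl : ∀ m → (m =ᴹ m) ≡ true
=ᴹ-refl (a , b) rewrite ≡ᵇ-refl a | ≡ᵇ-refl b = refl

occ-∷ : ∀ m x l → occ m (x ∷ l) ≡ 𝟙 (m =ᴹ x) + occ m l
occ-∷ m = countᵇ-∷ (m =ᴹ_)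

occ-pos⇒∈ : ∀ m l → 1 ≤ occ m l → m ∈ l
occ-pos⇒∈ m l h with countᵇ-pos (m =ᴹ_) l h
... | m′ , m′∈l , m=m′ rewrite =ᴹ⇒≡ {m} {m′} m=m′ = m′∈l

sameMonomial⇒occ : ∀ l k → sameMonomial l k ≡ true → ∀ m → occ m l ≡ occ m k
sameMonomial⇒occ l k h m with occ m l in ol | occ m k in ok
... | zero  | zero  = refl
... | suc a | _     = trans (sym ol) (trans (≡ᵇ⇒≡′ (all-elim _ h
                        (∈-++⁺ˡ (occ-pos⇒∈ m l (subst (1 ≤_) (sym ol) (s≤s z≤n)))))) ok)
... | zero  | suc b = trans (sym ol) (trans (≡ᵇ⇒≡′ (all-elim _ h
                        (∈-++⁺ʳ l (occ-pos⇒∈ m k (subst (1 ≤_) (sym ok) (s≤s z≤n)))))) ok)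

occ⇒sameMonomial : ∀ l k → (∀ m → occ m l ≡ occ m k) → sameMonomial l k ≡ true
occ⇒sameMonomial l k h = all-intro _ (l ++ k) (λ m _ → ≡⇒≡ᵇ′ (h m))

occ-fixedDegree : ∀ w d e S → occ (w , d) (map (λ u → (u , e)) S) ≡ (if d ≡ᵇ e then mult w S else 0)
occ-fixedDegree w d e [] with d ≡ᵇ e
... | true  = refl
... | false = refl
occ-fixedDegree w d e (u ∷ S) rewrite occ-∷ (w , d) (u , e) (map (λ u → (u , e)) S)
  | occ-fixedDegree w d e S with d ≡ᵇ e
... | true  = cong (λ b → 𝟙 b + mult w S) (∧-identityʳ (w ≡ᵇ u))
... | false = cong (λ b → 𝟙 b + 0) (∧-zeroʳ (w ≡ᵇ u))

-- ∏_{s ∈ S} z_{s,1}, the counterpart of zU for two-vertex components.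
zEdges : List ℕ → List Mark
zEdges = map (λ s → (s , 1))

occ-target₀ : ∀ w S R → occ (w , 0) (zEdges S ++ zU R) ≡ mult w R
occ-target₀ w S R =
  trans (countᵇ-++ _ (zEdges S) (zU R)) (cong₂ _+_ (occ-fixedDegree w 0 1 S) (occ-fixedDegree w 0 0 R))

occ-target₁ : ∀ w S R → occ (w , 1) (zEdges S ++ zU R) ≡ mult w S
occ-target₁ w S R = trans (countᵇ-++ _ (zEdges S) (zU R))
  (trans (cong₂ _+_ (occ-fixedDegree w 1 1 S) (occ-fixedDegree w 1 0 R)) (+-identityʳ (mult w S)))

occ-target₂₊ : ∀ w d S R → occ (w , suc (suc d)) (zEdges S ++ zU R) ≡ 0
occ-target₂₊ w d S R = trans (countᵇ-++ _ (zEdges S) (zU R))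
  (cong₂ _+_ (occ-fixedDegree w (suc (suc d)) 1 S) (occ-fixedDegree w (suc (suc d)) 0 R))

occ-monomial : ∀ {n} (ω : Fin n → ℕ) A m →
  occ m (monomial ω A) ≡ count (λ x → isRep A x ∧ (m =ᴹ compMark ω A x))
occ-monomial {n} ω A m = begin
  occ m (monomial ω A)
    ≡⟨ countᵇ-map (m =ᴹ_) (compMark ω A) (filterᵇ (isRep A) (allFin n)) ⟩
  countᵇ ((m =ᴹ_) ∘ compMark ω A) (filterᵇ (isRep A) (allFin n))
    ≡⟨ countᵇ-filterᵇ _ (isRep A) (allFin n) ⟩
  countᵇ (λ x → isRep A x ∧ (m =ᴹ compMark ω A x)) (allFin n)
    ≡⟨ countᵇ-tabulate {n = n} _ id ⟩
  count (λ x → isRep A x ∧ (m =ᴹ compMark ω A x)) ∎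
  where open ≡-Reasoning

-- Matchings

Matching : ∀ {n} → List (Edge n) → Set
Matching A = All (λ e → proj₁ e ≢ proj₂ e) A × AllPairs (λ e f → disjointEdges e f ≡ true) A

allPairs-∈ : ∀ {X : Set} {R : X → X → Set} {xs : List X} {x y} → AllPairs R xs → x ∈ xs → y ∈ xs →
  x ≡ y ⊎ R x y ⊎ R y x
allPairs-∈ (_ ∷ _)  (here refl) (here refl) = inj₁ refl
allPairs-∈ (Rx ∷ _) (here refl) (there y∈) = inj₂ (inj₁ (All.lookup Rx y∈))
allPairs-∈ (Ry ∷ _) (there x∈) (here refl) = inj₂ (inj₂ (All.lookup Ry x∈))
allPairs-∈ (_ ∷ R)  (there x∈) (there y∈) = allPairs-∈ R x∈ y∈

matching-common⇒≡ : ∀ {n} {A : List (Edge n)} → Matching A → ∀ {e f} → e ∈ A → f ∈ A →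
  ∀ v → isEndpoint e v ≡ true → isEndpoint f v ≡ true → e ≡ f
matching-common⇒≡ (_ , disj) {e} {f} e∈A f∈A v ev fv with allPairs-∈ disj e∈A f∈A
... | inj₁ e≡f        = e≡f
... | inj₂ (inj₁ e#f) = ⊥-elim (disjoint⇒¬common e f e#f v ev fv)
... | inj₂ (inj₂ f#e) = ⊥-elim (disjoint⇒¬common f e f#e v fv ev)

if-∨ : ∀ p q (v : ℕ) → (if q then 0 else (if p then 0 else v)) ≡ (if p ∨ q then 0 else v)
if-∨ true  true  v = refl
if-∨ true  false v = refl
if-∨ false true  v = refl
if-∨ false false v = refl

∑-split-edge : ∀ {n} (f : Fin n → ℕ) (e : Edge n) → proj₁ e ≢ proj₂ e →
  ∑ f ≡ f (proj₁ e) + (f (proj₂ e) + ∑ (λ x → if isEndpoint e x then 0 else f x))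
∑-split-edge f (a , b) a≢b =
  trans (∑-remove f a) (cong (f a +_) (trans (∑-remove _ b) (cong₂ _+_ (if-==-distinct f a b a≢b) (∑-cong off-ab))))
  where
  off-ab : ∀ x → (if x == b then 0 else (if x == a then 0 else f x)) ≡ (if (a == x) ∨ (b == x) then 0 else f x)
  off-ab x rewrite ==-sym x a | ==-sym x b = if-∨ (a == x) (b == x) (f x)

∈-endpoints : ∀ {n} {A : List (Edge n)} {x} → x ∈ endpoints A → ∃[ e ] (e ∈ A × isEndpoint e x ≡ true)
∈-endpoints {A = (a , b) ∷ A} (here refl)         = (a , b) , here refl , isEndpoint₁ (a , b)
∈-endpoints {A = (a , b) ∷ A} (there (here refl)) = (a , b) , here refl , isEndpoint₂ (a , b)
∈-endpoints {A = (a , b) ∷ A} (there (there x∈)) with ∈-endpoints x∈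
... | e , e∈A , ex = e , there e∈A , ex

∑-matching : ∀ {n} (A : List (Edge n)) → Matching A → (f : Fin n → ℕ) →
  ∑ f ≡ sum (map f (endpoints A)) + ∑ (λ x → if covered A x then 0 else f x)
∑-matching [] _ f = refl
∑-matching ((a , b) ∷ A) (a≢b ∷ loopless , e#A ∷ disjoint) f = begin
  ∑ f
    ≡⟨ ∑-split-edge f (a , b) a≢b ⟩
  f a + (f b + ∑ f-off-e)
    ≡⟨ cong (λ s → f a + (f b + s)) (∑-matching A (loopless , disjoint) f-off-e) ⟩
  f a + (f b + (sum (map f-off-e (endpoints A)) + ∑ (uncovered-by-A f-off-e)))
    ≡⟨ cong (λ s → f a + (f b + s)) (cong₂ _+_ same-on-A same-off-A) ⟩
  f a + (f b + (sum (map f (endpoints A)) + ∑ (uncovered-by-A′ f)))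
    ≡⟨ reassoc (f a) (f b) _ _ ⟩
  f a + (f b + sum (map f (endpoints A))) + ∑ (uncovered-by-A′ f) ∎
  where
  open ≡-Reasoning
  f-off-e : _ → ℕ
  f-off-e x = if isEndpoint (a , b) x then 0 else f x
  uncovered-by-A uncovered-by-A′ : (_ → ℕ) → _ → ℕ
  uncovered-by-A g x = if covered A x then 0 else g x
  uncovered-by-A′ g x = if covered ((a , b) ∷ A) x then 0 else g x
  reassoc : ∀ w x y z → w + (x + (y + z)) ≡ w + (x + y) + z
  reassoc w x y z = trans (cong (w +_) (sym (+-assoc x y z))) (sym (+-assoc w (x + y) z))
  off-e : ∀ {x} → x ∈ endpoints A → f-off-e x ≡ f x
  off-e x∈ with ∈-endpoints x∈
  ... | e , e∈A , ex rewrite ¬-not (λ h → disjoint⇒¬common (a , b) e (All.lookup e#A e∈A) _ h ex) = refl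
  same-on-A : sum (map f-off-e (endpoints A)) ≡ sum (map f (endpoints A))
  same-on-A = cong sum (map-cong-local (All.tabulate off-e))
  same-off-A : ∑ (uncovered-by-A f-off-e) ≡ ∑ (uncovered-by-A′ f)
  same-off-A = ∑-cong (λ x → if-∨ (isEndpoint (a , b) x) (covered A x) (f x))

module MatchingComponents {n : ℕ} (A : List (Edge n)) (M : Matching A) where
  open Components A public

  loopless : ∀ {e} → e ∈ A → proj₁ e ≢ proj₂ e
  loopless = All.lookup (proj₁ M)

  Adjacent : Fin n → Fin n → Bool
  Adjacent x y = (x == y) ∨ any (λ e → links e x y) A

  adjacent-step : ∀ {x} e → e ∈ A → ∀ {z y} → Adjacent x z ≡ true → links e z y ≡ true → Adjacent x y ≡ true
  adjacent-step {x} e e∈A {z} {y} x~z ezy with ∨-elim (x == z) x~z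
  ... | inj₁ x=z = subst (λ w → Adjacent w y ≡ true) (sym (==⇒≡ x=z)) (∨-introʳ (z == y) (any-intro _ e∈A ezy))
  ... | inj₂ p with any-elim _ A p
  ...   | f , f∈A , fxz
    with matching-common⇒≡ M e∈A f∈A z (links⇒isEndpointˡ e z y ezy) (links⇒isEndpointʳ f x z fxz)
  ...     | refl with links-elim e z y ezy | links-elim e x z fxz
  ...       | inj₁ (refl , refl) | inj₁ (_ , e₂≡e₁) = ⊥-elim (loopless e∈A (sym e₂≡e₁))
  ...       | inj₁ (refl , refl) | inj₂ (refl , _)  = ∨-introˡ (==-refl x)
  ...       | inj₂ (refl , refl) | inj₁ (refl , _)  = ∨-introˡ (==-refl x)
  ...       | inj₂ (refl , refl) | inj₂ (_ , e₁≡e₂) = ⊥-elim (loopless e∈A e₁≡e₂)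

  reach⇒adjacent : ∀ k {x y} → Reach k x y ≡ true → Adjacent x y ≡ true
  reach⇒adjacent zero    h = ∨-introˡ h
  reach⇒adjacent (suc k) {x} h with reach⇒lastStep {x} {k} h
  ... | stay p        = reach⇒adjacent k p
  ... | fwd {e} e∈A p = adjacent-step e e∈A (reach⇒adjacent k p) (links₁₂ e)
  ... | bwd {e} e∈A p = adjacent-step e e∈A (reach⇒adjacent k p) (links₂₁ e)

  connected-linked : ∀ {e} → e ∈ A → ∀ {x y} → links e x y ≡ true → ∀ u → connected A x u ≡ true → u ≡ x ⊎ u ≡ y
  connected-linked {e} e∈A {x} {y} exy u x~u with ∨-elim (x == u) (reach⇒adjacent n x~u)
  ... | inj₁ p = inj₁ (sym (==⇒≡ p))
  ... | inj₂ p with any-elim _ A p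
  ...   | f , f∈A , fxu
    with matching-common⇒≡ M e∈A f∈A x (links⇒isEndpointˡ e x y exy) (links⇒isEndpointˡ f x u fxu)
  ...     | refl with links-elim e x y exy | links-elim e x u fxu
  ...       | inj₁ (refl , refl) | inj₁ (_ , refl) = inj₂ refl
  ...       | inj₁ (refl , refl) | inj₂ (e₂≡e₁ , _) = ⊥-elim (loopless e∈A (sym e₂≡e₁))
  ...       | inj₂ (refl , refl) | inj₁ (e₁≡e₂ , _) = ⊥-elim (loopless e∈A e₁≡e₂)
  ...       | inj₂ (refl , refl) | inj₂ (_ , refl) = inj₂ refl

  connected-uncovered : ∀ x → covered A x ≡ false → ∀ y → connected A x y ≡ true → y ≡ x
  connected-uncovered x x-free y h with ∨-elim (x == y) (reach⇒adjacent n h)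
  ... | inj₁ p = sym (==⇒≡ p)
  ... | inj₂ p with any-elim _ A p
  ...   | f , f∈A , fxy = ⊥-elim (true≢false (trans (sym (any-intro _ f∈A (links⇒isEndpointˡ f x y fxy))) x-free))

edgeWeight : ∀ {n} → (Fin n → ℕ) → Edge n → ℕ
edgeWeight ω (a , b) = ω a + ω b

sum-endpoints : ∀ {n} (f : Fin n → ℕ) (g : Edge n → ℕ) B →
  (∀ {e} → e ∈ B → f (proj₁ e) + f (proj₂ e) ≡ g e) → sum (map f (endpoints B)) ≡ sum (map g B)
sum-endpoints f g []            h = refl
sum-endpoints f g ((a , b) ∷ B) h =
  trans (sym (+-assoc (f a) (f b) _)) (cong₂ _+_ (h (here refl)) (sum-endpoints f g B (h ∘ there)))

occ-zEdges : ∀ {n} (ω : Fin n → ℕ) m B →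
  occ m (zEdges (map (edgeWeight ω) B)) ≡ sum (map (λ e → 𝟙 (m =ᴹ (edgeWeight ω e , 1))) B)
occ-zEdges ω m []      = refl
occ-zEdges ω m (e ∷ B) = trans (occ-∷ m _ _) (cong (𝟙 (m =ᴹ (edgeWeight ω e , 1)) +_) (occ-zEdges ω m B))

mult-weights : ∀ {n} (ω : Fin n → ℕ) w → mult w (weights ω) ≡ count (λ x → w ≡ᵇ ω x)
mult-weights {n} ω w = trans (mult-map (allFin n)) (countᵇ-tabulate (λ x → w ≡ᵇ ω x) id)
  where
  mult-map : ∀ xs → mult w (map ω xs) ≡ countᵇ (λ x → w ≡ᵇ ω x) xs
  mult-map []       = refl
  mult-map (x ∷ xs) = trans (cong (𝟙 (w ≡ᵇ ω x) +_) (mult-map xs)) (sym (countᵇ-∷ _ x xs))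

mult-endpoints : ∀ {n} (ω : Fin n → ℕ) w B →
  sum (map (λ x → 𝟙 (w ≡ᵇ ω x)) (endpoints B)) ≡ mult w (map ω (endpoints B))
mult-endpoints ω w []            = refl
mult-endpoints ω w ((a , b) ∷ B) = cong (λ s → 𝟙 (w ≡ᵇ ω a) + (𝟙 (w ≡ᵇ ω b) + s)) (mult-endpoints ω w B)

module MatchingMonomial {n : ℕ} (A : List (Edge n)) (M : Matching A) (ω : Fin n → ℕ) where
  open MatchingComponents A M

  compMark-linked : ∀ {e} → e ∈ A → ∀ {x y} → links e x y ≡ true → compMark ω A x ≡ (ω x + ω y , 1)
  compMark-linked e∈A {x} {y} exy rewrite compMark≡ ω x =
    cong₂ _,_ (trans (∑-supported-at₂ _ x y x≢y (λ z z≢x z≢y → if-false (ω z) (outside z z≢x z≢y)))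
                     (cong₂ _+_ (if-true (ω x) (connected-refl x)) (if-true (ω y) x~y)))
              (cong (_∸ 1) (trans (∑-supported-at₂ _ x y x≢y (λ z z≢x z≢y → cong 𝟙 (outside z z≢x z≢y)))
                     (cong₂ _+_ (cong 𝟙 (connected-refl x)) (cong 𝟙 x~y))))
    where
    x≢y = links⇒≢ (loopless e∈A) exy
    x~y = links⇒connected e∈A exy
    outside : ∀ z → z ≢ x → z ≢ y → connected A x z ≡ false
    outside z z≢x z≢y = ¬-not λ x~z → [ z≢x , z≢y ] (connected-linked e∈A exy z x~z)

  isRep-linked : ∀ {e} → e ∈ A → ∀ {x y} → links e x y ≡ true → toℕ x < toℕ y → isRep A x ≡ true × isRep A y ≡ false
  isRep-linked e∈A {x} {y} exy x<y = minimal⇒isRep below-x , ¬-not y-not-rep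
    where
    below-x : ∀ u → toℕ u < toℕ x → connected A u x ≡ false
    below-x u u<x = ¬-not λ u~x → [ (λ u≡x → <-irrefl (cong toℕ u≡x) u<x)
                                  , (λ u≡y → <-asym u<x (subst (λ v → toℕ x < toℕ v) (sym u≡y) x<y)) ]
                                  (connected-linked e∈A exy u (connected-sym u~x))
    y-not-rep : isRep A y ≢ true
    y-not-rep y-rep = true≢false (trans (sym (links⇒connected e∈A exy)) (isRep⇒minimal y-rep x x<y))

  isRep-uncovered : ∀ x → covered A x ≡ false → isRep A x ≡ true
  isRep-uncovered x x-free =
    minimal⇒isRep λ u u<x → ¬-not λ u~x →
      <-irrefl (cong toℕ (connected-uncovered x x-free u (connected-sym u~x))) u<x

  compMark-uncovered : ∀ x → covered A x ≡ false → compMark ω A x ≡ (ω x , 0)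
  compMark-uncovered x x-free rewrite compMark≡ ω x =
    cong₂ _,_ (trans (∑-supported-at _ x (λ y y≢x → if-false (ω y) (outside y y≢x)))
                     (if-true (ω x) (connected-refl x)))
              (cong (_∸ 1) (trans (∑-supported-at _ x (λ y y≢x → cong 𝟙 (outside y y≢x)))
                                  (cong 𝟙 (connected-refl x))))
    where
    outside : ∀ y → y ≢ x → connected A x y ≡ false
    outside y y≢x = ¬-not (λ x~y → y≢x (connected-uncovered x x-free y x~y))

  counted : Mark → Fin n → Bool
  counted m x = isRep A x ∧ (m =ᴹ compMark ω A x)

  -- Exactly one endpoint of an edge of the matching represents its component.
  counted-edge : ∀ {e} → e ∈ A → ∀ m →
    𝟙 (counted m (proj₁ e)) + 𝟙 (counted m (proj₂ e)) ≡ 𝟙 (m =ᴹ (edgeWeight ω e , 1))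
  counted-edge {a , b} e∈A m
    rewrite compMark-linked e∈A (links₁₂ (a , b)) | compMark-linked e∈A (links₂₁ (a , b)) | +-comm (ω b) (ω a)
    with <-cmp (toℕ a) (toℕ b)
  ... | tri≈ _ a≡b _ = ⊥-elim (loopless e∈A (toℕ-injective a≡b))
  ... | tri< a<b _ _ rewrite proj₁ (isRep-linked e∈A (links₁₂ (a , b)) a<b)
                           | proj₂ (isRep-linked e∈A (links₁₂ (a , b)) a<b) = +-identityʳ _
  ... | tri> _ _ b<a rewrite proj₁ (isRep-linked e∈A (links₂₁ (a , b)) b<a)
                           | proj₂ (isRep-linked e∈A (links₂₁ (a , b)) b<a) = refl

  occ-monomial-matching : ∀ m → occ m (monomial ω A) ≡
    occ m (zEdges (map (edgeWeight ω) A)) + ∑ (λ x → if covered A x then 0 else 𝟙 (m =ᴹ (ω x , 0)))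
  occ-monomial-matching m = begin
    occ m (monomial ω A)                                    ≡⟨ occ-monomial ω A m ⟩
    count (counted m)                                       ≡⟨ ∑-matching A M (𝟙 ∘ counted m) ⟩
    sum (map (𝟙 ∘ counted m) (endpoints A)) + ∑ (λ x → if covered A x then 0 else 𝟙 (counted m x))
      ≡⟨ cong₂ _+_ (trans (sum-endpoints _ _ A (λ e∈A → counted-edge e∈A m)) (sym (occ-zEdges ω m A)))
                   (∑-cong uncovered) ⟩
    occ m (zEdges (map (edgeWeight ω) A)) + ∑ (λ x → if covered A x then 0 else 𝟙 (m =ᴹ (ω x , 0))) ∎
    where
    open ≡-Reasoning
    uncovered : ∀ x → (if covered A x then 0 else 𝟙 (counted m x)) ≡ (if covered A x then 0 else 𝟙 (m =ᴹ (ω x , 0)))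
    uncovered x with covered A x in x-free
    ... | true  = refl
    ... | false rewrite isRep-uncovered x x-free | compMark-uncovered x x-free = refl

  occ₀-matching : ∀ w → occ (w , 0) (monomial ω A) + mult w (map ω (endpoints A)) ≡ mult w (weights ω)
  occ₀-matching w = begin
    occ (w , 0) (monomial ω A) + mult w (map ω (endpoints A))
      ≡⟨ cong (_+ mult w (map ω (endpoints A))) (trans (occ-monomial-matching (w , 0))
           (cong₂ _+_ (occ-fixedDegree w 0 1 (map (edgeWeight ω) A)) (∑-cong uncovered))) ⟩
    ∑ uncovered-of-weight-w + mult w (map ω (endpoints A))
      ≡⟨ +-comm (∑ uncovered-of-weight-w) _ ⟩
    mult w (map ω (endpoints A)) + ∑ uncovered-of-weight-w
      ≡⟨ cong (_+ ∑ uncovered-of-weight-w) (sym (mult-endpoints ω w A)) ⟩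
    sum (map (λ x → 𝟙 (w ≡ᵇ ω x)) (endpoints A)) + ∑ uncovered-of-weight-w
      ≡⟨ sym (∑-matching A M (λ x → 𝟙 (w ≡ᵇ ω x))) ⟩
    count (λ x → w ≡ᵇ ω x)
      ≡⟨ sym (mult-weights ω w) ⟩
    mult w (weights ω) ∎
    where
    open ≡-Reasoning
    uncovered-of-weight-w : Fin n → ℕ
    uncovered-of-weight-w x = if covered A x then 0 else 𝟙 (w ≡ᵇ ω x)
    uncovered : ∀ x → (if covered A x then 0 else 𝟙 ((w , 0) =ᴹ (ω x , 0))) ≡ uncovered-of-weight-w x
    uncovered x = cong (λ b → if covered A x then 0 else 𝟙 b) (∧-identityʳ (w ≡ᵇ ω x))

  occ₊-matching : ∀ w d → occ (w , suc d) (monomial ω A) ≡ occ (w , suc d) (zEdges (map (edgeWeight ω) A))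
  occ₊-matching w d = trans (occ-monomial-matching (w , suc d))
    (trans (cong (occ (w , suc d) (zEdges (map (edgeWeight ω) A)) +_) (∑-zero uncovered)) (+-identityʳ _))
    where
    uncovered : ∀ x → (if covered A x then 0 else 𝟙 ((w , suc d) =ᴹ (ω x , 0))) ≡ 0
    uncovered x rewrite ∧-zeroʳ (w ≡ᵇ ω x) with covered A x
    ... | true  = refl
    ... | false = refl

module _ {n : ℕ} (A : List (Edge n)) (M : Matching A) (ω : Fin n → ℕ) (S R : List ℕ) where
  open MatchingMonomial A M ω

  monomial-matching⇒ : sameMonomial (monomial ω A) (zEdges S ++ zU R) ≡ true →
    weights ω ≈ₘ map ω (endpoints A) ++ R × map (edgeWeight ω) A ≈ₘ S
  monomial-matching⇒ same = mult-≡ vertexWeights , mult-≡ edgeWeights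
    where
    occ-same : ∀ m → occ m (monomial ω A) ≡ occ m (zEdges S ++ zU R)
    occ-same = sameMonomial⇒occ (monomial ω A) (zEdges S ++ zU R) same
    vertexWeights : ∀ w → mult w (weights ω) ≡ mult w (map ω (endpoints A) ++ R)
    vertexWeights w = begin
      mult w (weights ω)                                         ≡⟨ sym (occ₀-matching w) ⟩
      occ (w , 0) (monomial ω A) + mult w (map ω (endpoints A))
        ≡⟨ cong (_+ _) (trans (occ-same (w , 0)) (occ-target₀ w S R)) ⟩
      mult w R + mult w (map ω (endpoints A))                    ≡⟨ +-comm (mult w R) _ ⟩
      mult w (map ω (endpoints A)) + mult w R                    ≡⟨ sym (mult-++ w (map ω (endpoints A)) R) ⟩
      mult w (map ω (endpoints A) ++ R)                          ∎
      where open ≡-Reasoning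
    edgeWeights : ∀ w → mult w (map (edgeWeight ω) A) ≡ mult w S
    edgeWeights w = begin
      mult w (map (edgeWeight ω) A)                 ≡⟨ sym (occ-fixedDegree w 1 1 (map (edgeWeight ω) A)) ⟩
      occ (w , 1) (zEdges (map (edgeWeight ω) A))   ≡⟨ sym (occ₊-matching w 0) ⟩
      occ (w , 1) (monomial ω A)                    ≡⟨ occ-same (w , 1) ⟩
      occ (w , 1) (zEdges S ++ zU R)                ≡⟨ occ-target₁ w S R ⟩
      mult w S                                      ∎
      where open ≡-Reasoning

  monomial-matching⇐ : weights ω ≈ₘ map ω (endpoints A) ++ R → map (edgeWeight ω) A ≈ₘ S →
    sameMonomial (monomial ω A) (zEdges S ++ zU R) ≡ true
  monomial-matching⇐ vertexWeights edgeWeights = occ⇒sameMonomial (monomial ω A) (zEdges S ++ zU R) occ-same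
    where
    occ-same : ∀ m → occ m (monomial ω A) ≡ occ m (zEdges S ++ zU R)
    occ-same (w , zero) = trans (+-cancelʳ-≡ (mult w endpointWeights) _ _ occ+ep≡R+ep) (sym (occ-target₀ w S R))
      where
      endpointWeights = map ω (endpoints A)
      occ+ep≡R+ep : occ (w , 0) (monomial ω A) + mult w endpointWeights ≡ mult w R + mult w endpointWeights
      occ+ep≡R+ep = begin
        occ (w , 0) (monomial ω A) + mult w endpointWeights  ≡⟨ occ₀-matching w ⟩
        mult w (weights ω)                                  ≡⟨ same-mult vertexWeights w ⟩
        mult w (endpointWeights ++ R)                       ≡⟨ mult-++ w endpointWeights R ⟩
        mult w endpointWeights + mult w R                   ≡⟨ +-comm (mult w endpointWeights) (mult w R) ⟩
        mult w R + mult w endpointWeights                   ∎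
        where open ≡-Reasoning
    occ-same (w , suc zero) = trans (occ₊-matching w 0) (trans (occ-fixedDegree w 1 1 (map (edgeWeight ω) A))
      (trans (same-mult edgeWeights w) (sym (occ-target₁ w S R))))
    occ-same (w , suc (suc d)) = trans (occ₊-matching w (suc d))
      (trans (occ-fixedDegree w (suc (suc d)) 1 (map (edgeWeight ω) A)) (sym (occ-target₂₊ w d S R)))

SimpleEdges : ∀ {n} → List (Edge n) → Set
SimpleEdges A = All (λ e → proj₁ e ≢ proj₂ e) A × AllPairs (λ e f → sameEdge e f ≡ false) A

links-sameEdge : ∀ {n} (e f : Edge n) {x y} → links e x y ≡ true → links f x y ≡ true → sameEdge e f ≡ true
links-sameEdge e f {x} {y} exy fxy with links-elim e x y exy | links-elim f x y fxy
... | inj₁ (refl , refl) | inj₁ (refl , refl) = ∨-introˡ (∧-intro (==-refl x) (==-refl y))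
... | inj₁ (refl , refl) | inj₂ (refl , refl) = ∨-introʳ ((x == y) ∧ (y == x)) (∧-intro (==-refl x) (==-refl y))
... | inj₂ (refl , refl) | inj₁ (refl , refl) = ∨-introʳ ((y == x) ∧ (x == y)) (∧-intro (==-refl y) (==-refl x))
... | inj₂ (refl , refl) | inj₂ (refl , refl) = ∨-introˡ (∧-intro (==-refl y) (==-refl x))

allPairs-map-∈ : ∀ {X : Set} {R S : X → X → Set} {xs : List X} →
  (∀ {x y} → x ∈ xs → y ∈ xs → R x y → S x y) → AllPairs R xs → AllPairs S xs
allPairs-map-∈ f []           = []
allPairs-map-∈ f (Rx ∷ Rxs) =
  All.tabulate (λ y∈ → f (here refl) (there y∈) (All.lookup Rx y∈)) ∷
  allPairs-map-∈ (λ x∈ y∈ → f (there x∈) (there y∈)) Rxs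

module NoHighDegree {n : ℕ} (ω : Fin n → ℕ) (A : List (Edge n))
                    (none : ∀ w d → occ (w , suc (suc d)) (monomial ω A) ≡ 0) where
  open Components A

  degree≥2 : ∀ s → 3 ≤ s → ∃[ d ] (s ∸ 1 ≡ suc (suc d))
  degree≥2 (suc (suc (suc d))) _               = d , refl
  degree≥2 (suc (suc zero))    (s≤s (s≤s ()))
  degree≥2 (suc zero)          (s≤s ())

  no-big-component : ∀ r → isRep A r ≡ true → 3 ≤ componentSize r → ⊥
  no-big-component r r-rep big with degree≥2 (componentSize r) big
  ... | d , size∸1 = <-irrefl refl (subst (1 ≤_) occurs-not occurs)
    where
    occurs : 1 ≤ occ (compMark ω A r) (monomial ω A)
    occurs = subst (1 ≤_) (sym (occ-monomial ω A (compMark ω A r)))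
                   (count≥1 _ r (∧-intro r-rep (=ᴹ-refl (compMark ω A r))))
    mark-r : compMark ω A r ≡ (proj₁ (compMark ω A r) , suc (suc d))
    mark-r = cong (proj₁ (compMark ω A r) ,_) (trans (cong proj₂ (compMark≡ ω r)) size∸1)
    occurs-not : occ (compMark ω A r) (monomial ω A) ≡ 0
    occurs-not = trans (cong (λ m → occ m (monomial ω A)) mark-r) (none (proj₁ (compMark ω A r)) d)

  -- Two distinct edges through a common vertex v span at least three vertices.
  simple⇒matching : SimpleEdges A → Matching A
  simple⇒matching (loopless , distinct) = loopless , allPairs-map-∈ disjoint distinct
    where
    disjoint : ∀ {e f} → e ∈ A → f ∈ A → sameEdge e f ≡ false → disjointEdges e f ≡ true
    disjoint {e} {f} e∈A f∈A e≠f = ¬-not λ meet → common (¬disjoint⇒common e f meet)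
      where
      common : ∃[ v ] (isEndpoint e v ≡ true × isEndpoint f v ≡ true) → ⊥
      common (v , ev , fv) with isEndpoint⇒links e v ev | isEndpoint⇒links f v fv | rep-exists v
      ... | y , evy | z , fvz | r , r-rep , r~v =
        no-big-component r r-rep (count≥3 (connected A r) v y z
          (links⇒≢ (All.lookup loopless e∈A) evy) (links⇒≢ (All.lookup loopless f∈A) fvz)
          (λ { refl → true≢false (trans (sym (links-sameEdge e f evy fvz)) e≠f) })
          r~v (connected-trans r~v (links⇒connected e∈A evy)) (connected-trans r~v (links⇒connected f∈A fvz)))

-- Counting subsets

subsets⇒⊆ : ∀ {X : Set} (xs : List X) {A} → A ∈ subsets xs → A ⊆ xs
subsets⇒⊆ []       (here refl) = []
subsets⇒⊆ (x ∷ xs) A∈ with ∈-++⁻ (subsets xs) A∈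
... | inj₁ A∈′ = x ∷ʳ subsets⇒⊆ xs A∈′
... | inj₂ A∈′ with ∈-map⁻ (x ∷_) A∈′
...   | A′ , A′∈ , refl = refl ∷ subsets⇒⊆ xs A′∈

∈-unorderedPairs : ∀ {X : Set} (xs : List X) {e f} → (e , f) ∈ unorderedPairs xs → e ∈ xs × f ∈ xs
∈-unorderedPairs (x ∷ xs) ef∈ with ∈-++⁻ (map (x ,_) xs) ef∈
... | inj₁ ef∈′ with ∈-map⁻ (x ,_) ef∈′
...   | f , f∈ , refl = here refl , there f∈
∈-unorderedPairs (x ∷ xs) ef∈ | inj₂ ef∈′ with ∈-unorderedPairs xs ef∈′
...   | e∈ , f∈ = there e∈ , there f∈

AllPairs-resp-⊆ : ∀ {X : Set} {R : X → X → Set} {A xs : List X} → A ⊆ xs → AllPairs R xs → AllPairs R A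
AllPairs-resp-⊆ []            []         = []
AllPairs-resp-⊆ (_ ∷ʳ A⊆)     (_ ∷ Rxs)  = AllPairs-resp-⊆ A⊆ Rxs
AllPairs-resp-⊆ (refl ∷ A⊆)   (Rx ∷ Rxs) = All-resp-⊆ A⊆ Rx ∷ AllPairs-resp-⊆ A⊆ Rxs

simpleEdges-⊆ : ∀ {n} {A E : List (Edge n)} → A ⊆ E → SimpleEdges E → SimpleEdges A
simpleEdges-⊆ A⊆E (loopless , distinct) = All-resp-⊆ A⊆E loopless , AllPairs-resp-⊆ A⊆E distinct

isEmpty : ∀ {X : Set} → List X → Bool
isEmpty []      = true
isEmpty (_ ∷ _) = false

singletonWith : ∀ {X : Set} → (X → Bool) → List X → Bool
singletonWith J (e ∷ []) = J e
singletonWith J _        = false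

pairWith : ∀ {X : Set} → (X × X → Bool) → List X → Bool
pairWith G (e ∷ f ∷ []) = G (e , f)
pairWith G _            = false

countᵇ-isEmpty-subsets : ∀ {X : Set} (xs : List X) → countᵇ isEmpty (subsets xs) ≡ 1
countᵇ-isEmpty-subsets []       = refl
countᵇ-isEmpty-subsets (x ∷ xs) = trans (countᵇ-++ isEmpty (subsets xs) _) (cong₂ _+_ (countᵇ-isEmpty-subsets xs)
  (trans (countᵇ-map isEmpty (x ∷_) (subsets xs)) (countᵇ-zero _ (subsets xs) (λ _ _ → refl))))

countᵇ-singletonWith-subsets : ∀ {X : Set} (J : X → Bool) xs → countᵇ (singletonWith J) (subsets xs) ≡ countᵇ J xs
countᵇ-singletonWith-subsets J []       = refl
countᵇ-singletonWith-subsets J (x ∷ xs) = begin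
  countᵇ (singletonWith J) (subsets xs ++ map (x ∷_) (subsets xs))
    ≡⟨ countᵇ-++ (singletonWith J) (subsets xs) _ ⟩
  countᵇ (singletonWith J) (subsets xs) + countᵇ (singletonWith J) (map (x ∷_) (subsets xs))
    ≡⟨ cong₂ _+_ (countᵇ-singletonWith-subsets J xs) (countᵇ-map (singletonWith J) (x ∷_) (subsets xs)) ⟩
  countᵇ J xs + countᵇ (λ A → singletonWith J (x ∷ A)) (subsets xs)
    ≡⟨ cong (countᵇ J xs +_) (with-x (J x) refl) ⟩
  countᵇ J xs + 𝟙 (J x)
    ≡⟨ trans (+-comm (countᵇ J xs) (𝟙 (J x))) (sym (countᵇ-∷ J x xs)) ⟩
  countᵇ J (x ∷ xs) ∎
  where
  open ≡-Reasoning
  -- Among the subsets containing x, only {x} itself is a singleton.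
  with-x : ∀ b → J x ≡ b → countᵇ (λ A → singletonWith J (x ∷ A)) (subsets xs) ≡ 𝟙 b
  with-x true  Jx = trans (countᵇ-cong (subsets xs) (λ A _ → only-[] A)) (countᵇ-isEmpty-subsets xs)
    where
    only-[] : ∀ A → singletonWith J (x ∷ A) ≡ isEmpty A
    only-[] []      = Jx
    only-[] (_ ∷ _) = refl
  with-x false Jx = countᵇ-zero _ (subsets xs) (λ A _ → never A)
    where
    never : ∀ A → singletonWith J (x ∷ A) ≡ false
    never []      = Jx
    never (_ ∷ _) = refl

countᵇ-pairWith-subsets : ∀ {X : Set} (G : X × X → Bool) xs →
  countᵇ (pairWith G) (subsets xs) ≡ countᵇ G (unorderedPairs xs)
countᵇ-pairWith-subsets G []       = refl
countᵇ-pairWith-subsets G (x ∷ xs) = begin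
  countᵇ (pairWith G) (subsets xs ++ map (x ∷_) (subsets xs))
    ≡⟨ countᵇ-++ (pairWith G) (subsets xs) _ ⟩
  countᵇ (pairWith G) (subsets xs) + countᵇ (pairWith G) (map (x ∷_) (subsets xs))
    ≡⟨ cong₂ _+_ (countᵇ-pairWith-subsets G xs) (countᵇ-map (pairWith G) (x ∷_) (subsets xs)) ⟩
  countᵇ G (unorderedPairs xs) + countᵇ (λ A → pairWith G (x ∷ A)) (subsets xs)
    ≡⟨ cong (countᵇ G (unorderedPairs xs) +_) (trans (countᵇ-cong (subsets xs) (λ A _ → pair-with-x A))
                                                     (countᵇ-singletonWith-subsets (λ y → G (x , y)) xs)) ⟩
  countᵇ G (unorderedPairs xs) + countᵇ (λ y → G (x , y)) xs
    ≡⟨ cong (countᵇ G (unorderedPairs xs) +_) (sym (countᵇ-map G (x ,_) xs)) ⟩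
  countᵇ G (unorderedPairs xs) + countᵇ G (map (x ,_) xs)
    ≡⟨ trans (+-comm (countᵇ G (unorderedPairs xs)) _) (sym (countᵇ-++ G (map (x ,_) xs) (unorderedPairs xs))) ⟩
  countᵇ G (unorderedPairs (x ∷ xs)) ∎
  where
  open ≡-Reasoning
  pair-with-x : ∀ A → pairWith G (x ∷ A) ≡ singletonWith (λ y → G (x , y)) A
  pair-with-x []          = refl
  pair-with-x (_ ∷ [])    = refl
  pair-with-x (_ ∷ _ ∷ _) = refl

joins⇒≈ₘ : ∀ {n} (ω : Fin n → ℕ) p q (e : Edge n) →
  joins ω p q e ≡ true → ω (proj₁ e) ∷ ω (proj₂ e) ∷ [] ≈ₘ p ∷ q ∷ []
joins⇒≈ₘ ω p q (u , v) h with ∨-elim ((ω u ≡ᵇ p) ∧ (ω v ≡ᵇ q)) h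
... | inj₁ r = ≈ₘ-pair⁺ (inj₁ (≡ᵇ⇒≡′ (∧-elimˡ (ω u ≡ᵇ p) r) , ≡ᵇ⇒≡′ (∧-elimʳ (ω u ≡ᵇ p) r)))
... | inj₂ r = ≈ₘ-pair⁺ (inj₂ (≡ᵇ⇒≡′ (∧-elimˡ (ω u ≡ᵇ q) r) , ≡ᵇ⇒≡′ (∧-elimʳ (ω u ≡ᵇ q) r)))

≈ₘ⇒joins : ∀ {n} (ω : Fin n → ℕ) p q (e : Edge n) →
  ω (proj₁ e) ∷ ω (proj₂ e) ∷ [] ≈ₘ p ∷ q ∷ [] → joins ω p q e ≡ true
≈ₘ⇒joins ω p q (u , v) h with ≈ₘ-pair⁻ h
... | inj₁ (r₁ , r₂) = ∨-introˡ (∧-intro (≡⇒≡ᵇ′ r₁) (≡⇒≡ᵇ′ r₂))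
... | inj₂ (r₁ , r₂) = ∨-introʳ ((ω u ≡ᵇ p) ∧ (ω v ≡ᵇ q)) (∧-intro (≡⇒≡ᵇ′ r₁) (≡⇒≡ᵇ′ r₂))

module _ {x y z t w₀ w₁ w₂ : ℕ} where

  two-pairs⇒ : x ∷ y ∷ z ∷ t ∷ [] ≈ₘ w₀ ∷ w₀ ∷ w₁ ∷ w₂ ∷ [] → x + y ∷ z + t ∷ [] ≈ₘ w₀ + w₁ ∷ w₀ + w₂ ∷ [] →
    (x ∷ y ∷ [] ≈ₘ w₀ ∷ w₁ ∷ [] × z ∷ t ∷ [] ≈ₘ w₀ ∷ w₂ ∷ []) ⊎
    (x ∷ y ∷ [] ≈ₘ w₀ ∷ w₂ ∷ [] × z ∷ t ∷ [] ≈ₘ w₀ ∷ w₁ ∷ [])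
  two-pairs⇒ vertices sums with ≈ₘ-pair⁻ sums
  ... | inj₁ (x+y , _) = inj₁ (≈ₘ-split-by-sum vertices x+y)
  ... | inj₂ (x+y , _) = inj₂ (≈ₘ-split-by-sum (≈ₘ-trans vertices (≈ₘ-∷ w₀ (≈ₘ-∷ w₀ (≈ₘ-swap w₁ w₂ [])))) x+y)

  two-pairs⇐ : (x ∷ y ∷ [] ≈ₘ w₀ ∷ w₁ ∷ [] × z ∷ t ∷ [] ≈ₘ w₀ ∷ w₂ ∷ []) ⊎
               (x ∷ y ∷ [] ≈ₘ w₀ ∷ w₂ ∷ [] × z ∷ t ∷ [] ≈ₘ w₀ ∷ w₁ ∷ []) →
    x ∷ y ∷ z ∷ t ∷ [] ≈ₘ w₀ ∷ w₀ ∷ w₁ ∷ w₂ ∷ [] × x + y ∷ z + t ∷ [] ≈ₘ w₀ + w₁ ∷ w₀ + w₂ ∷ []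
  two-pairs⇐ (inj₁ (xy , zt)) =
    ≈ₘ-trans (≈ₘ-++ xy zt) (≈ₘ-∷ w₀ (≈ₘ-swap w₁ w₀ _)) ,
    ≈ₘ-pair⁺ (inj₁ (≈ₘ-pair⇒sum xy , ≈ₘ-pair⇒sum zt))
  two-pairs⇐ (inj₂ (xy , zt)) =
    ≈ₘ-trans (≈ₘ-++ xy zt) (≈ₘ-trans (≈ₘ-∷ w₀ (≈ₘ-swap w₂ w₀ _)) (≈ₘ-∷ w₀ (≈ₘ-∷ w₀ (≈ₘ-swap w₂ w₁ [])))) ,
    ≈ₘ-pair⁺ (inj₂ (≈ₘ-pair⇒sum xy , ≈ₘ-pair⇒sum zt))

-- The coefficients α and β

module Coefficients {n : ℕ} (ω : Fin n → ℕ) where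

  HasMonomial : List (Edge n) → List Mark → Set
  HasMonomial A T = sameMonomial (monomial ω A) T ≡ true

  matching-of-monomial : ∀ {A} S R → SimpleEdges A → HasMonomial A (zEdges S ++ zU R) → Matching A
  matching-of-monomial {A} S R simple same = NoHighDegree.simple⇒matching ω A none simple
    where
    none : ∀ w d → occ (w , suc (suc d)) (monomial ω A) ≡ 0
    none w d = trans (sameMonomial⇒occ (monomial ω A) _ same (w , suc (suc d))) (occ-target₂₊ w d S R)

  size-mismatch : ∀ {A} S R → SimpleEdges A → length A ≢ length S →
    sameMonomial (monomial ω A) (zEdges S ++ zU R) ≡ false
  size-mismatch {A} S R simple ≢S = ¬-not λ same → ≢S (trans (sym (length-map (edgeWeight ω) A))
    (≈ₘ-length _ S (proj₂ (monomial-matching⇒ A (matching-of-monomial S R simple same) ω S R same))))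

  endpoints-too-heavy : ∀ {A} xs → Matching A → removeAll xs (weights ω) ≡ nothing → ¬ (map ω (endpoints A) ≈ₘ xs)
  endpoints-too-heavy {A} xs M missing fits with removeAll-nothing xs (weights ω) missing
  ... | w , few = <-irrefl refl (<-≤-trans few (subst (_≤ mult w (weights ω)) (same-mult fits w)
                    (subst (mult w (map ω (endpoints A)) ≤_) (MatchingMonomial.occ₀-matching A M ω w) (m≤n+m _ _))))

  single-edge : ∀ {e : Edge n} → proj₁ e ≢ proj₂ e → Matching (e ∷ [])
  single-edge e₁≢e₂ = e₁≢e₂ ∷ [] , [] ∷ []

  two-edges : ∀ {e f : Edge n} → proj₁ e ≢ proj₂ e → proj₁ f ≢ proj₂ f → disjointEdges e f ≡ true →
    Matching (e ∷ f ∷ [])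
  two-edges e₁≢e₂ f₁≢f₂ e#f = e₁≢e₂ ∷ f₁≢f₂ ∷ [] , (e#f ∷ []) ∷ [] ∷ []

  module _ (w₁ w₂ : ℕ) where

    α-subset : ∀ R → weights ω ≈ₘ w₁ ∷ w₂ ∷ R → ∀ A → SimpleEdges A →
      sameMonomial (monomial ω A) (zEdges (w₁ + w₂ ∷ []) ++ zU R) ≡ singletonWith (joins ω w₁ w₂) A
    α-subset R removed []          simple = size-mismatch _ R simple (λ ())
    α-subset R removed (e ∷ f ∷ A) simple = size-mismatch _ R simple (λ ())
    α-subset R removed ((a , b) ∷ []) simple@(a≢b ∷ [] , _) = bool-ext to from
      where
      to : HasMonomial ((a , b) ∷ []) (zEdges (w₁ + w₂ ∷ []) ++ zU R) → joins ω w₁ w₂ (a , b) ≡ true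
      to same = ≈ₘ⇒joins ω w₁ w₂ (a , b) (≈ₘ-cancelʳ R (≈ₘ-trans (≈ₘ-sym vertices) removed))
        where vertices = proj₁ (monomial-matching⇒ _ (single-edge a≢b) ω _ R same)
      from : joins ω w₁ w₂ (a , b) ≡ true → HasMonomial ((a , b) ∷ []) (zEdges (w₁ + w₂ ∷ []) ++ zU R)
      from joined = monomial-matching⇐ _ (single-edge a≢b) ω _ R
        (≈ₘ-trans removed (≈ₘ-++ (≈ₘ-sym ab) ≈ₘ-refl)) (≈ₘ-reflexive (cong (_∷ []) (≈ₘ-pair⇒sum ab)))
        where ab = joins⇒≈ₘ ω w₁ w₂ (a , b) joined

    α≡numJoining : ∀ E → SimpleEdges E → α ω E w₁ w₂ ≡ numJoining ω E w₁ w₂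
    α≡numJoining E simple with removeAll (w₁ ∷ w₂ ∷ []) (weights ω) in removal
    ... | just R = trans (countᵇ-cong (subsets E) (λ A A∈ →
                           α-subset R (removeAll-just _ _ removal) A (simpleEdges-⊆ (subsets⇒⊆ E A∈) simple)))
                         (countᵇ-singletonWith-subsets (joins ω w₁ w₂) E)
    ... | nothing = sym (countᵇ-zero (joins ω w₁ w₂) E no-edge)
      where
      no-edge : ∀ e → e ∈ E → joins ω w₁ w₂ e ≡ false
      no-edge (a , b) e∈E = ¬-not λ joined → endpoints-too-heavy (w₁ ∷ w₂ ∷ [])
        (single-edge (All.lookup (proj₁ simple) e∈E)) removal (joins⇒≈ₘ ω w₁ w₂ (a , b) joined)

  module _ (w₀ w₁ w₂ : ℕ) where

    weightsFit : Edge n → Edge n → Bool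
    weightsFit e f = (joins ω w₀ w₁ e ∧ joins ω w₀ w₂ f) ∨ (joins ω w₀ w₂ e ∧ joins ω w₀ w₁ f)

    weightsFit⇒≈ₘ : ∀ a b c d → weightsFit (a , b) (c , d) ≡ true →
      ω a ∷ ω b ∷ ω c ∷ ω d ∷ [] ≈ₘ w₀ ∷ w₀ ∷ w₁ ∷ w₂ ∷ [] × ω a + ω b ∷ ω c + ω d ∷ [] ≈ₘ w₀ + w₁ ∷ w₀ + w₂ ∷ []
    weightsFit⇒≈ₘ a b c d fit with ∨-elim (joins ω w₀ w₁ (a , b) ∧ joins ω w₀ w₂ (c , d)) fit
    ... | inj₁ p = two-pairs⇐ (inj₁ (joins⇒≈ₘ ω w₀ w₁ (a , b) (∧-elimˡ (joins ω w₀ w₁ (a , b)) p) ,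
                                     joins⇒≈ₘ ω w₀ w₂ (c , d) (∧-elimʳ (joins ω w₀ w₁ (a , b)) p)))
    ... | inj₂ p = two-pairs⇐ (inj₂ (joins⇒≈ₘ ω w₀ w₂ (a , b) (∧-elimˡ (joins ω w₀ w₂ (a , b)) p) ,
                                     joins⇒≈ₘ ω w₀ w₁ (c , d) (∧-elimʳ (joins ω w₀ w₂ (a , b)) p)))

    ≈ₘ⇒weightsFit : ∀ a b c d → ω a ∷ ω b ∷ ω c ∷ ω d ∷ [] ≈ₘ w₀ ∷ w₀ ∷ w₁ ∷ w₂ ∷ [] →
      ω a + ω b ∷ ω c + ω d ∷ [] ≈ₘ w₀ + w₁ ∷ w₀ + w₂ ∷ [] → weightsFit (a , b) (c , d) ≡ true
    ≈ₘ⇒weightsFit a b c d vertices sums with two-pairs⇒ vertices sums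
    ... | inj₁ (ab , cd) = ∨-introˡ (∧-intro (≈ₘ⇒joins ω w₀ w₁ (a , b) ab) (≈ₘ⇒joins ω w₀ w₂ (c , d) cd))
    ... | inj₂ (ab , cd) = ∨-introʳ (joins ω w₀ w₁ (a , b) ∧ joins ω w₀ w₂ (c , d))
                                    (∧-intro (≈ₘ⇒joins ω w₀ w₂ (a , b) ab) (≈ₘ⇒joins ω w₀ w₁ (c , d) cd))

    β-subset : ∀ R → weights ω ≈ₘ w₀ ∷ w₀ ∷ w₁ ∷ w₂ ∷ R → ∀ A → SimpleEdges A →
      sameMonomial (monomial ω A) (zEdges (w₀ + w₁ ∷ w₀ + w₂ ∷ []) ++ zU R) ≡ pairWith (goodPair ω w₀ w₁ w₂) A
    β-subset R removed []              simple = size-mismatch _ R simple (λ ())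
    β-subset R removed (e ∷ [])        simple = size-mismatch _ R simple (λ ())
    β-subset R removed (e ∷ f ∷ g ∷ A) simple = size-mismatch _ R simple (λ ())
    β-subset R removed ((a , b) ∷ (c , d) ∷ []) simple@(a≢b ∷ c≢d ∷ [] , _) = bool-ext to from
      where
      S = w₀ + w₁ ∷ w₀ + w₂ ∷ []
      to : HasMonomial ((a , b) ∷ (c , d) ∷ []) (zEdges S ++ zU R) → goodPair ω w₀ w₁ w₂ ((a , b) , (c , d)) ≡ true
      to same with matching-of-monomial S R simple same
      ... | M@(_ , (disjoint ∷ []) ∷ _) with monomial-matching⇒ _ M ω S R same
      ...   | vertices , sums =
        ∧-intro disjoint (≈ₘ⇒weightsFit a b c d (≈ₘ-cancelʳ R (≈ₘ-trans (≈ₘ-sym vertices) removed)) sums)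
      from : goodPair ω w₀ w₁ w₂ ((a , b) , (c , d)) ≡ true → HasMonomial ((a , b) ∷ (c , d) ∷ []) (zEdges S ++ zU R)
      from good = monomial-matching⇐ _ (two-edges a≢b c≢d (∧-elimˡ (disjointEdges (a , b) (c , d)) good)) ω S R
        (≈ₘ-trans removed (≈ₘ-++ (≈ₘ-sym (proj₁ fit)) ≈ₘ-refl)) (proj₂ fit)
        where fit = weightsFit⇒≈ₘ a b c d (∧-elimʳ (disjointEdges (a , b) (c , d)) good)

    β≡numIndepPairs : ∀ E → SimpleEdges E → β ω E w₀ w₁ w₂ ≡ numIndepPairs ω E w₀ w₁ w₂
    β≡numIndepPairs E simple with removeAll (w₀ ∷ w₀ ∷ w₁ ∷ w₂ ∷ []) (weights ω) in removal
    ... | just R = trans (countᵇ-cong (subsets E) (λ A A∈ →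
                           β-subset R (removeAll-just _ _ removal) A (simpleEdges-⊆ (subsets⇒⊆ E A∈) simple)))
                         (countᵇ-pairWith-subsets (goodPair ω w₀ w₁ w₂) E)
    ... | nothing = sym (countᵇ-zero (goodPair ω w₀ w₁ w₂) (unorderedPairs E) no-pair)
      where
      no-pair : ∀ p → p ∈ unorderedPairs E → goodPair ω w₀ w₁ w₂ p ≡ false
      no-pair ((a , b) , (c , d)) p∈ with ∈-unorderedPairs E p∈
      ... | e∈E , f∈E = ¬-not λ good → endpoints-too-heavy (w₀ ∷ w₀ ∷ w₁ ∷ w₂ ∷ [])
        (two-edges (All.lookup (proj₁ simple) e∈E) (All.lookup (proj₁ simple) f∈E)
                   (∧-elimˡ (disjointEdges (a , b) (c , d)) good))
        removal (proj₁ (weightsFit⇒≈ₘ a b c d (∧-elimʳ (disjointEdges (a , b) (c , d)) good)))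

lemma7p7 : (n : ℕ) (E : List (Edge n)) (ω : Fin n → ℕ) →
    IsTree n E → (∀ v → 0 < ω v) →
    ((w₁ w₂ : ℕ) → w₁ ∈ weights ω → w₂ ∈ weights ω →
      α ω E w₁ w₂ ≡ numJoining ω E w₁ w₂)
    ×
    ((w₀ w₁ w₂ : ℕ) → w₀ ∈ weights ω → w₁ ∈ weights ω → w₂ ∈ weights ω →
      β ω E w₀ w₁ w₂ ≡ numIndepPairs ω E w₀ w₁ w₂)
lemma7p7 n E ω tree _ =
  (λ w₁ w₂ _ _ → α≡numJoining w₁ w₂ E simple) ,
  (λ w₀ w₁ w₂ _ _ _ → β≡numIndepPairs w₀ w₁ w₂ E simple)
  where
  open Coefficients ω
  simple : SimpleEdges E
  simple = IsTree.loopless tree , IsTree.noMultiple tree
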